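{- Let $t$ be a parameter, $N_n(t)=\sum_{i=1}^n\frac1n\binom ni\binom n{i-1}t^i$ for $n\ge1$, $N_0(t)=1$, and $N(x,t)=\sum_{n\ge0}N_n(t)x^n=\frac{1-(t-1)x-\sqrt{1-2(1+t)x+(1-t)^2x^2}}{2x}$. Let $\mathcal{D}^*_n$ be the set of Dyck paths of length $2n$ in which each peak has weight $t$ (all other steps weight $1$), and let $\mathcal{U}_n$ be the subset of $\mathcal{D}^*_n$ of paths whose first two steps are not $\mathbf{ud}$. Let $\mathcal{V}_n$ be the set of weighted Dyck paths of length $2n$ described in the context, with weight functions $\alpha(x)=tx$, $\beta(x)=\frac{N(x,t)-1}{t}$ and $\gamma(x)=x(N(x,t)-1)$. Then there exists a (weight-preserving) bijection between $\mathcal{U}_n$ and $\mathcal{V}_n$.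
   Context: A peak of a Dyck path is an occurrence of $\mathbf{ud}$. $N_n(t)$ is the total weight of $\mathcal{D}^*_n$, where the weight of a path is $t$ to the number of its peaks. A Dyck path of length $2n$ is a lattice path from $(0,0)$ to $(2n,0)$ with steps $\mathbf{u}=(1,1)$, $\mathbf{d}=(1,-1)$ never going below the $x$-axis. A valley is an occurrence of $\mathbf{du}$; its level is the ordinate of the common point of its two steps. A pyramid is a consecutive section $\mathbf{u}^h\mathbf{d}^h$ ($h\ge1$ its height); it is maximal if it cannot be extended to $\mathbf{u}^{h+1}\mathbf{d}^{h+1}$; its altitude is the ordinate of the endpoint of its last $\mathbf{d}$-step. A Dyck path is primitive if it is nonempty and touches the $x$-axis only at its endpoints. Given weight functions $\alpha(x)=\sum_{k\ge1}\alpha_kx^k$, $\beta(x)=\sum_{k\ge1}\beta_kx^k$, $\gamma(x)=\sum_{k\ge1}\gamma_kx^k$, let $\mathcal{A}_n$ be the set of primitive Dyck paths $P$ of length $2n$ all of whose valleys lie at the same level, weighted by: $w(\mathbf{u}^n\mathbf{d}^n)=\gamma_n$, and for $P=\mathbf{u}^k\mathbf{u}^{i_1}\mathbf{d}^{i_1}\cdots\mathbf{u}^{i_r}\mathbf{d}^{i_r}\mathbf{d}^k$ ($k\ge1$, $r\ge2$, $i_j\ge1$), $w(P)=\beta_k\alpha_{i_1}\cdots\alpha_{i_r}$; only paths of nonzero weight are kept. $\mathcal{V}_n$ is the set of Dyck paths of length $2n$ that are concatenations of zero or more paths from $\bigcup_{s\ge1}\mathcal{A}_s$, weighted by the product of the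 weights of the factors (empty path: weight $1$). A bijection between sets of weighted paths whose weights are polynomials with nonnegative integer coefficients in the parameters is understood in the weight-preserving sense: each path is regarded as a collection of copies, one per monomial term counted with multiplicity, and the bijection matches these copies with equal monomial weights. -}

module Defs where

open import Data.Nat using (ℕ; zero; suc; _+_; _*_; _∸_; _/_)
open import Data.Nat.Combinatorics using (_C_)
open import Data.Bool using (Bool; true; false; _∧_; not)
open import Data.List using (List; []; _∷_; _++_; length; map; upTo; concatMap; replicate)
open import Data.Nat.ListAction using (sum)
open import Data.Fin using (Fin)
open import Data.Product using (Σ; _×_; proj₁; proj₂)
open import Relation.Binary.PropositionalEquality using (_≡_)

-- Polynomials in t with ℕ coefficients, as coefficient functions:
-- p k = coefficient of t^k.

Poly : Set
Poly = ℕ → ℕ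

poly0 : Poly
poly0 _ = 0

poly1 : Poly
poly1 zero    = 1
poly1 (suc _) = 0

tPow : ℕ → Poly
tPow zero    zero    = 1
tPow zero    (suc _) = 0
tPow (suc m) zero    = 0
tPow (suc m) (suc k) = tPow m k

_*P_ : Poly → Poly → Poly
(p *P q) k = sum (map (λ j → p j * q (k ∸ j)) (upTo (suc k)))

prodP : List Poly → Poly
prodP []       = poly1
prodP (p ∷ ps) = p *P prodP ps

data Step : Set where
  u d : Step

dyckFrom : ℕ → List Step → Bool
dyckFrom zero    []       = true
dyckFrom (suc _) []       = false
dyckFrom h       (u ∷ s)  = dyckFrom (suc h) s
dyckFrom zero    (d ∷ s)  = false
dyckFrom (suc h) (d ∷ s)  = dyckFrom h s

record DyckPath (n : ℕ) : Set where
  constructor mkDyck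
  field
    steps   : List Step
    len     : length steps ≡ n + n
    isDyck  : dyckFrom 0 steps ≡ true
open DyckPath public

peaks : List Step → ℕ
peaks []            = 0
peaks (u ∷ d ∷ s)   = suc (peaks (d ∷ s))
peaks (_ ∷ s)       = peaks s

startsUD : List Step → Bool
startsUD (u ∷ d ∷ _) = true
startsUD _           = false

-- Weighted sets and weight-preserving bijections.
-- A weighted element x with polynomial weight w x is regarded as
-- (w x k) copies of weight t^k for each k.

Copies : (X : Set) → (X → Poly) → Set
Copies X w = Σ X λ x → Σ ℕ λ k → Fin (w x k)

degree : {X : Set} {w : X → Poly} → Copies X w → ℕ
degree c = proj₁ (proj₂ c)

peakWeight : {n : ℕ} → DyckPath n → Poly
peakWeight P = tPow (peaks (steps P))

record UPath (n : ℕ) : Set where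
  constructor mkU
  field
    path   : DyckPath n
    notUD  : startsUD (steps path) ≡ false
open UPath public

UCopies : ℕ → Set
UCopies n = Copies (UPath n) (λ P → peakWeight (path P))

-- The set A = ⋃_s A_s of primitive paths with all valleys at the same
-- level, given by their (unique) shape.  Heights are encoded as suc _
-- so that they are ≥ 1.
--   pyr n           ↦  u^{n+1} d^{n+1}                        (weight γ_{n+1})
--   fan k i₁ i₂ is  ↦  u^{k+1} u^{i₁+1}d^{i₁+1} u^{i₂+1}d^{i₂+1} ⋯ d^{k+1}
--                      (r = 2 + length is ≥ 2; weight β_{k+1} α_{i₁+1} ⋯)

data AShape : Set where
  pyr : ℕ → AShape
  fan : ℕ → ℕ → ℕ → List ℕ → AShape

pyramid : ℕ → List Step
pyramid h = replicate h u ++ replicate h d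

shapeSteps : AShape → List Step
shapeSteps (pyr n)          = pyramid (suc n)
shapeSteps (fan k i₁ i₂ is) =
  replicate (suc k) u ++
  (concatMap (λ i → pyramid (suc i)) (i₁ ∷ i₂ ∷ is) ++ replicate (suc k) d)

-- general weights: α β γ give the coefficient (a polynomial in t) of x^k
shapeWeight : (α β γ : ℕ → Poly) → AShape → Poly
shapeWeight α β γ (pyr n)          = γ (suc n)
shapeWeight α β γ (fan k i₁ i₂ is) =
  β (suc k) *P prodP (map (λ i → α (suc i)) (i₁ ∷ i₂ ∷ is))

-- Since the
-- factorisation (and the shape of each factor) is unique, the weight of
-- a path P is the sum over factorisations S of P of the weight of S;
-- copies are therefore indexed by (P, S, k, j).
record VPath (n : ℕ) : Set where
  constructor mkV
  field
    vpath    : DyckPath n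
    factors  : List AShape
    factorEq : concatMap shapeSteps factors ≡ steps vpath
open VPath public

VWeight : (α β γ : ℕ → Poly) → {n : ℕ} → VPath n → Poly
VWeight α β γ P = prodP (map (shapeWeight α β γ) (factors P))

VCopies : (α β γ : ℕ → Poly) → ℕ → Set
VCopies α β γ n = Copies (VPath n) (VWeight α β γ)

narayanaPoly : ℕ → Poly
narayanaPoly zero          = poly1
narayanaPoly (suc m) zero    = 0
narayanaPoly (suc m) (suc i) = ((suc m C suc i) * (suc m C i)) / suc m

NminusOne : ℕ → Poly
NminusOne zero    = poly0
NminusOne (suc m) = narayanaPoly (suc m)

-- α(x) = t x
αN : ℕ → Poly
αN 1 = tPow 1
αN _ = poly0

-- β(x) = (N(x,t) - 1)/t : coefficient of x^k is (N_k(t) for k ≥ 1)/t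
βN : ℕ → Poly
βN k j = NminusOne k (suc j)

-- γ(x) = x (N(x,t) - 1) : coefficient of x^k is [x^{k-1}](N - 1)
γN : ℕ → Poly
γN zero    = poly0
γN (suc m) = NminusOne m

-- Both sides are free monoids on one graded set of blocks. Reading a Dyck path as a plane forest, a
-- path that does not start with u d splits uniquely into blocks u P d (u d)^ℓ with P a non-empty
-- Dyck path; if P has semilength m and j peaks, the block has semilength m + 1 + ℓ and j + ℓ peaks.
-- A factor of a path in V is either a pyramid u^{m+1} d^{m+1} of weight γ_{m+1} = N_m(t), or a fan
-- whose α-weights force its inner pyramids to be u d, of weight β_{k+1} t^{r+2}. Since the
-- coefficient of t^j in N_m(t) counts the Dyck paths of semilength m with j peaks, the terms of
-- pyramids match the blocks with ℓ = 0 and the terms of fans those with ℓ = r + 1.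
--
-- That count D(m, k) comes from double counting paths with a marked peak: removing the peak leaves
-- a shorter path with a marked gap, whence (k+1)·D(m+1,k+1) = (k+1)·D(m,k+1) + (2m+1−k)·D(m,k), and
-- by induction m·D(m,k+1) = C(m,k+1)·C(m,k).

module Submission where

open import Defs
open import Axiom.UniquenessOfIdentityProofs.WithK using (uip)
open import Data.Bool.Base using (Bool; true; false; not; if_then_else_)
import Data.Bool.Properties as Bool
open import Data.Empty using (⊥; ⊥-elim)
open import Data.Fin.Base using (Fin; zero; suc)
open import Data.Fin.Permutation using (↔⇒≡)
open import Data.Fin.Properties using (+↔⊎; *↔×)
open import Data.List.Base using (List; []; _∷_; length; _++_; map; replicate; concatMap; applyUpTo)
open import Data.List.Properties using (length-++; length-replicate; ++-assoc; ∷-injectiveʳ)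
open import Data.Nat.Base using (ℕ; zero; suc; _+_; _*_; _∸_; _^_; _/_; _≤_; s≤s; ⌊_/2⌋)
open import Data.Nat.Combinatorics using (_C_; nC1≡n; k>n⇒nCk≡0; nCk+nC[k+1]≡[n+1]C[k+1])
open import Data.Nat.DivMod using (m*n/n≡m)
open import Data.Nat.ListAction using (sum)
open import Data.Nat.Properties
  using ( _≟_; _≤?_; suc-injective; +-suc; +-assoc; +-identityʳ; *-identityʳ; *-zeroʳ; *-comm
        ; *-distribˡ-+; *-distribʳ-+; +-cancelˡ-≡; *-cancelˡ-≡; m+n∸m≡n; m*n≡0⇒m≡0
        ; ≤-refl; ≤-trans; m≤m+n; m≤n+m; n≤1+n; ≰⇒>; m<n⇒m<1+n; m≤n⇒∃[o]m+o≡n; n≡⌊n+n/2⌋ )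
open import Data.Nat.Tactic.RingSolver using (solve-∀)
open import Data.Product.Base using (Σ; _×_; _,_; proj₁; proj₂)
open import Data.Product.Function.Dependent.Propositional using (Σ-↔; congˡ)
open import Data.Product.Function.NonDependent.Propositional using (_×-cong_)
open import Data.Sum.Base using (_⊎_; inj₁; inj₂)
open import Data.Sum.Function.Propositional using (_⊎-cong_)
open import Data.Unit.Base using (⊤; tt)
open import Function.Bundles using (_↔_; Inverse; mk↔ₛ′; Bijection; _⤖_)
open import Function.Properties.Inverse using (↔-refl; ↔-sym; ↔-trans; ↔⇒⤖)
open import Function.Related.Propositional using (bijection)
open import Function.Related.TypeIsomorphisms using (Σ-distribˡ-⊎)
open import Relation.Binary.PropositionalEquality using (_≡_; refl; sym; trans; cong; cong₂; subst; module ≡-Reasoning)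
open import Relation.Nullary.Decidable using (Dec; _×-dec_; does; yes; no)
open import Relation.Nullary.Irrelevant using (Irrelevant)
open import Relation.Unary using (Decidable)

private
  variable
    A : Set
    m n : ℕ

∑ : (Fin n → ℕ) → ℕ
∑ {zero}  f = 0
∑ {suc n} f = f zero + ∑ (λ i → f (suc i))

∑-const : (n c : ℕ) → ∑ {n} (λ _ → c) ≡ n * c
∑-const zero    c = refl
∑-const (suc n) c = cong (c +_) (∑-const n c)

Σ-↔ʳ : {B C : A → Set} → (∀ x → B x ↔ C x) → Σ A B ↔ Σ A C
Σ-↔ʳ e = congˡ {k = bijection} (λ {x} → e x)

card-unique : A ↔ Fin m → A ↔ Fin n → m ≡ n
card-unique e f = ↔⇒≡ (↔-trans (↔-sym e) f)

Fin-cong : m ≡ n → Fin m ↔ Fin n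
Fin-cong refl = ↔-refl

Σ-Fin-suc : {B : Fin (suc n) → Set} → Σ (Fin (suc n)) B ↔ (B zero ⊎ Σ (Fin n) (λ i → B (suc i)))
Σ-Fin-suc = mk↔ₛ′
  (λ { (zero , b) → inj₁ b ; (suc i , b) → inj₂ (i , b) })
  (λ { (inj₁ b) → zero , b ; (inj₂ (i , b)) → suc i , b })
  (λ { (inj₁ _) → refl ; (inj₂ _) → refl })
  (λ { (zero , _) → refl ; (suc _ , _) → refl })

Σ-Fin-↔ : {B : Fin n → Set} (f : Fin n → ℕ) → (∀ i → B i ↔ Fin (f i)) → Σ (Fin n) B ↔ Fin (∑ f)
Σ-Fin-↔ {zero}  f e = mk↔ₛ′ (λ ()) (λ ()) (λ ()) (λ ())
Σ-Fin-↔ {suc n} f e =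
  ↔-trans Σ-Fin-suc (↔-trans (e zero ⊎-cong Σ-Fin-↔ (λ i → f (suc i)) (λ i → e (suc i))) (↔-sym +↔⊎))

Σ-finite : {B : A → Set} (e : A ↔ Fin n) (f : A → ℕ) → (∀ x → B x ↔ Fin (f x)) →
           Σ A B ↔ Fin (∑ (λ i → f (Inverse.from e i)))
Σ-finite {B = B} e f fib =
  ↔-trans (↔-sym (Σ-↔ {B = B} (↔-sym e) ↔-refl)) (Σ-Fin-↔ _ (λ i → fib (Inverse.from e i)))

Σ-const-fibre : {B : A → Set} {c : ℕ} → A ↔ Fin n → (∀ x → B x ↔ Fin c) → Σ A B ↔ Fin (n * c)
Σ-const-fibre {n = n} {c = c} e fib = ↔-trans (Σ-finite e (λ _ → c) fib) (Fin-cong (∑-const n c))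

irrelevant-↔ : {B : Set} → Irrelevant A → Irrelevant B → (A → B) → (B → A) → A ↔ B
irrelevant-↔ irrA irrB f g = mk↔ₛ′ f g (λ _ → irrB _ _) (λ _ → irrA _ _)

≡-↔ : {B : Set} {a b : A} {c d : B} → (a ≡ b → c ≡ d) → (c ≡ d → a ≡ b) → (a ≡ b) ↔ (c ≡ d)
≡-↔ = irrelevant-↔ uip uip

indicator : Bool → ℕ
indicator true  = 1
indicator false = 0

≡true↔Fin-indicator : (b : Bool) → (b ≡ true) ↔ Fin (indicator b)
≡true↔Fin-indicator true  = mk↔ₛ′ (λ _ → zero) (λ _ → refl) (λ { zero → refl }) (λ { refl → refl })
≡true↔Fin-indicator false = mk↔ₛ′ (λ ()) (λ ()) (λ ()) (λ ())

count : (Fin n → Bool) → ℕ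
count p = ∑ (λ i → indicator (p i))

filter-true-Fin : (p : Fin n → Bool) → Σ (Fin n) (λ i → p i ≡ true) ↔ Fin (count p)
filter-true-Fin p = Σ-Fin-↔ (λ i → indicator (p i)) (λ i → ≡true↔Fin-indicator (p i))

count+count-not : (p : Fin n → Bool) → count p + count (λ i → not (p i)) ≡ n
count+count-not {zero}  p = refl
count+count-not {suc n} p with p zero | count+count-not (λ i → p (suc i))
... | true  | ih = cong suc ih
... | false | ih = trans (+-suc _ _) (cong suc ih)

filter-false-Fin : (p : Fin n → Bool) → Σ (Fin n) (λ i → p i ≡ false) ↔ Fin (n ∸ count p)
filter-false-Fin {n} p =
  ↔-trans (Σ-↔ʳ (λ i → irrelevant-↔ uip uip not-true not-false))
          (↔-trans (filter-true-Fin (λ i → not (p i)))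
                   (Fin-cong (trans (sym (m+n∸m≡n (count p) _)) (cong (_∸ count p) (count+count-not p)))))
  where
  not-true : {b : Bool} → b ≡ false → not b ≡ true
  not-true refl = refl
  not-false : {b : Bool} → not b ≡ true → b ≡ false
  not-false {false} _ = refl

Σ-dec-finite : {P : A → Set} (e : A ↔ Fin n) (P? : Decidable P) → (∀ x → Irrelevant (P x)) →
               Σ A P ↔ Fin (count (λ i → does (P? (Inverse.from e i))))
Σ-dec-finite {P = P} e P? irr = Σ-finite e (λ x → indicator (does (P? x))) fibre
  where
  fibre : ∀ x → P x ↔ Fin (indicator (does (P? x)))
  fibre x with P? x
  ... | yes p = irrelevant-↔ (irr x) (λ { zero zero → refl }) (λ _ → zero) (λ _ → p)
  ... | no ¬p = mk↔ₛ′ (λ p → ⊥-elim (¬p p)) (λ ()) (λ ()) (λ p → ⊥-elim (¬p p))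

ListOfLength : Set → ℕ → Set
ListOfLength A n = Σ (List A) (λ xs → length xs ≡ n)

ListOfLength-suc : (n : ℕ) → ListOfLength A (suc n) ↔ (A × ListOfLength A n)
ListOfLength-suc _ = mk↔ₛ′ (λ { (x ∷ xs , refl) → x , (xs , refl) }) (λ { (x , (xs , refl)) → x ∷ xs , refl })
                        (λ { (_ , (_ , refl)) → refl }) (λ { (_ ∷ _ , refl) → refl })

ListOfLength-finite : {a : ℕ} → A ↔ Fin a → (n : ℕ) → ListOfLength A n ↔ Fin (a ^ n)
ListOfLength-finite e zero    = mk↔ₛ′ (λ _ → zero) (λ _ → [] , refl) (λ { zero → refl }) (λ { ([] , refl) → refl })
ListOfLength-finite e (suc n) = ↔-trans (ListOfLength-suc n) (↔-trans (e ×-cong ListOfLength-finite e n) (↔-sym *↔×))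

Term : Poly → Set
Term p = Σ ℕ (λ k → Fin (p k))

sumUpTo : ℕ → (ℕ → ℕ) → ℕ
sumUpTo zero    f = 0
sumUpTo (suc n) f = f 0 + sumUpTo n (λ j → f (suc j))

sum-map-applyUpTo : (n : ℕ) (g h : ℕ → ℕ) → sum (map g (applyUpTo h n)) ≡ sumUpTo n (λ j → g (h j))
sum-map-applyUpTo zero    g h = refl
sum-map-applyUpTo (suc n) g h = cong (g (h 0) +_) (sum-map-applyUpTo n g (λ j → h (suc j)))

Decomposition : ℕ → (ℕ → ℕ → ℕ) → Set
Decomposition k f = Σ (ℕ × ℕ) (λ (j , l) → (j + l ≡ k) × Fin (f j l))

Fin-convolution : (k : ℕ) (f : ℕ → ℕ → ℕ) → Fin (sumUpTo (suc k) (λ j → f j (k ∸ j))) ↔ Decomposition k f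
Fin-convolution zero f = ↔-trans +↔⊎ (mk↔ₛ′
  (λ { (inj₁ c) → (0 , 0) , refl , c ; (inj₂ ()) })
  (λ { ((0 , 0) , refl , c) → inj₁ c })
  (λ { ((0 , 0) , refl , c) → refl })
  (λ { (inj₁ c) → refl ; (inj₂ ()) }))
Fin-convolution (suc k) f = ↔-trans +↔⊎ (↔-trans (↔-refl ⊎-cong Fin-convolution k (λ j l → f (suc j) l)) (mk↔ₛ′
  (λ { (inj₁ c) → (0 , suc k) , refl , c
     ; (inj₂ ((j , l) , j+l≡k , c)) → (suc j , l) , cong suc j+l≡k , c })
  (λ { ((0 , l) , refl , c) → inj₁ c
     ; ((suc j , l) , j+l≡k , c) → inj₂ ((j , l) , suc-injective j+l≡k , c) })
  (λ { ((0 , l) , refl , c) → refl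
     ; ((suc j , l) , _ , c) → cong (λ e → (suc j , l) , e , c) (uip _ _) })
  (λ { (inj₁ c) → refl
     ; (inj₂ ((j , l) , _ , c)) → cong (λ e → inj₂ ((j , l) , e , c)) (uip _ _) })))

Term-*P : (p q : Poly) → Term (p *P q) ↔ (Term p × Term q)
Term-*P p q = ↔-trans split (↔-trans forget-sum (mk↔ₛ′
  (λ ((j , l) , c) → let (a , b) = Inverse.to (*↔× {p j}) c in (j , a) , (l , b))
  (λ ((j , a) , (l , b)) → (j , l) , Inverse.from (*↔× {p j}) (a , b))
  (λ ((j , a) , (l , b)) → cong (λ (a , b) → (j , a) , (l , b)) (Inverse.strictlyInverseˡ (*↔× {p j}) (a , b)))
  (λ ((j , l) , c) → cong ((j , l) ,_) (Inverse.strictlyInverseʳ (*↔× {p j}) c))))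
  where
  f : ℕ → ℕ → ℕ
  f j l = p j * q l
  split : Term (p *P q) ↔ Σ ℕ (λ k → Decomposition k f)
  split = Σ-↔ʳ (λ k → ↔-trans (Fin-cong (sum-map-applyUpTo (suc k) _ (λ j → j))) (Fin-convolution k f))
  forget-sum : Σ ℕ (λ k → Decomposition k f) ↔ Σ (ℕ × ℕ) (λ (j , l) → Fin (f j l))
  forget-sum = mk↔ₛ′ (λ (_ , jl , _ , c) → jl , c) (λ ((j , l) , c) → j + l , (j , l) , refl , c)
                     (λ _ → refl) (λ { (_ , _ , refl , _) → refl })

degree-*P : (p q : Poly) (x : Term (p *P q)) →
            proj₁ (proj₁ (Inverse.to (Term-*P p q) x)) + proj₁ (proj₂ (Inverse.to (Term-*P p q) x)) ≡ proj₁ x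
degree-*P p q (k , _) = proj₁ (proj₂ (Inverse.to (Fin-convolution k (λ j l → p j * q l)) _))

Terms : List Poly → Set
Terms []       = ⊤
Terms (p ∷ ps) = Term p × Terms ps

degrees : (ps : List Poly) → Terms ps → ℕ
degrees []       _        = 0
degrees (p ∷ ps) (a , as) = proj₁ a + degrees ps as

Term-poly1 : Term poly1 ↔ ⊤
Term-poly1 = mk↔ₛ′ (λ _ → tt) (λ _ → 0 , zero) (λ _ → refl) (λ { (0 , zero) → refl })

Term-prodP : (ps : List Poly) → Term (prodP ps) ↔ Terms ps
Term-prodP []       = Term-poly1
Term-prodP (p ∷ ps) = ↔-trans (Term-*P p (prodP ps)) (↔-refl ×-cong Term-prodP ps)

degree-prodP : (ps : List Poly) (x : Term (prodP ps)) → degrees ps (Inverse.to (Term-prodP ps) x) ≡ proj₁ x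
degree-prodP []       (zero , zero) = refl
degree-prodP (p ∷ ps) x =
  trans (cong (proj₁ a +_) (degree-prodP ps b)) (degree-*P p (prodP ps) x)
  where
  a : Term p
  a = proj₁ (Inverse.to (Term-*P p (prodP ps)) x)
  b : Term (prodP ps)
  b = proj₂ (Inverse.to (Term-*P p (prodP ps)) x)

Term-tPow : (m : ℕ) → Term (tPow m) ↔ ⊤
Term-tPow zero    = mk↔ₛ′ (λ _ → tt) (λ _ → 0 , zero) (λ _ → refl) (λ { (0 , zero) → refl })
Term-tPow (suc m) = ↔-trans shift (Term-tPow m)
  where
  shift : Term (tPow (suc m)) ↔ Term (tPow m)
  shift = mk↔ₛ′ (λ { (suc k , c) → k , c }) (λ (k , c) → suc k , c) (λ _ → refl) (λ { (suc _ , _) → refl })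

degree-tPow : (m : ℕ) (x : Term (tPow m)) → proj₁ x ≡ m
degree-tPow zero    (zero , zero)  = refl
degree-tPow (suc m) (suc k , c)    = cong suc (degree-tPow m (k , c))

infixl 6 _⊕_
_⊕_ : ℕ × ℕ → ℕ × ℕ → ℕ × ℕ
(a , b) ⊕ (a′ , b′) = a + a′ , b + b′

⊕-assoc : (x y z : ℕ × ℕ) → (x ⊕ y) ⊕ z ≡ x ⊕ (y ⊕ z)
⊕-assoc (a , b) (a′ , b′) (a″ , b″) = cong₂ _,_ (+-assoc a a′ a″) (+-assoc b b′ b″)

record Graded : Set₁ where
  constructor graded
  field
    Carrier : Set
    grade   : Carrier → ℕ × ℕ
open Graded public

infix 4 _≅_
record _≅_ (A B : Graded) : Set where
  constructor mk≅
  field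
    iso             : Carrier A ↔ Carrier B
    grade-preserved : ∀ a → grade B (Inverse.to iso a) ≡ grade A a
open _≅_ public

≅-trans : {A B C : Graded} → A ≅ B → B ≅ C → A ≅ C
≅-trans (mk≅ e p) (mk≅ f q) = mk≅ (↔-trans e f) (λ a → trans (q _) (p a))

≅-sym : {A B : Graded} → A ≅ B → B ≅ A
≅-sym {B = B} (mk≅ e p) = mk≅ (↔-sym e) (λ b → trans (sym (p _)) (cong (grade B) (Inverse.strictlyInverseˡ e b)))

infixr 1 _⊎ᵍ_
_⊎ᵍ_ : Graded → Graded → Graded
A ⊎ᵍ B = graded (Carrier A ⊎ Carrier B) λ { (inj₁ a) → grade A a ; (inj₂ b) → grade B b }

⊎-≅ : {A B C D : Graded} → A ≅ B → C ≅ D → (A ⊎ᵍ C) ≅ (B ⊎ᵍ D)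
⊎-≅ (mk≅ e p) (mk≅ f q) = mk≅ (e ⊎-cong f) λ { (inj₁ a) → p a ; (inj₂ c) → q c }

gradeSum : (A → ℕ × ℕ) → List A → ℕ × ℕ
gradeSum g []       = 0 , 0
gradeSum g (x ∷ xs) = g x ⊕ gradeSum g xs

Listᵍ : Graded → Graded
Listᵍ A = graded (List (Carrier A)) (gradeSum (grade A))

List-≅ : {A B : Graded} → A ≅ B → Listᵍ A ≅ Listᵍ B
List-≅ {A} {B} (mk≅ e p) = mk≅ (mk↔ₛ′ (map to) (map from) to∘from from∘to) preserved
  where
  open Inverse e
  to∘from : ∀ ys → map to (map from ys) ≡ ys
  to∘from []       = refl
  to∘from (y ∷ ys) = cong₂ _∷_ (strictlyInverseˡ y) (to∘from ys)
  from∘to : ∀ xs → map from (map to xs) ≡ xs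
  from∘to []       = refl
  from∘to (x ∷ xs) = cong₂ _∷_ (strictlyInverseʳ x) (from∘to xs)
  preserved : ∀ xs → gradeSum (grade B) (map to xs) ≡ gradeSum (grade A) xs
  preserved []       = refl
  preserved (x ∷ xs) = cong₂ _⊕_ (p x) (preserved xs)

OfSize : Graded → ℕ → Set
OfSize A n = Σ (Carrier A) (λ a → proj₁ (grade A a) ≡ n)

OfSize-↔ : {A B : Graded} → A ≅ B → (n : ℕ) → OfSize A n ↔ OfSize B n
OfSize-↔ (mk≅ e p) n = Σ-↔ e λ {a} → ≡-↔ (trans (cong proj₁ (p a))) (trans (cong proj₁ (sym (p a))))


infixr 2 _×ᵍ_
_×ᵍ_ : Graded → Graded → Graded
A ×ᵍ B = graded (Carrier A × Carrier B) (λ (a , b) → grade A a ⊕ grade B b)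

×-≅ : {A B C D : Graded} → A ≅ B → C ≅ D → (A ×ᵍ C) ≅ (B ×ᵍ D)
×-≅ (mk≅ e p) (mk≅ f q) = mk≅ (e ×-cong f) (λ (a , c) → cong₂ _⊕_ (p a) (q c))

Gap : List Step → Set
Gap s = Fin (suc (length s))

insertPeak : (s : List Step) → Gap s → List Step
insertPeak s       zero    = u ∷ d ∷ s
insertPeak (x ∷ s) (suc g) = x ∷ insertPeak s g

data PeakAt : List Step → Set where
  here  : ∀ {s} → PeakAt (u ∷ d ∷ s)
  there : ∀ {x s} → PeakAt s → PeakAt (x ∷ s)

removePeak : {s : List Step} → PeakAt s → List Step
removePeak (here {s})    = s
removePeak (there {x} p) = x ∷ removePeak p

insertedPeak : (s : List Step) (g : Gap s) → PeakAt (insertPeak s g)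
insertedPeak s       zero    = here
insertedPeak (x ∷ s) (suc g) = there (insertedPeak s g)

removedGap : {s : List Step} (p : PeakAt s) → Gap (removePeak p)
removedGap here      = zero
removedGap (there p) = suc (removedGap p)

gapped↔peaked : Σ (List Step) Gap ↔ Σ (List Step) PeakAt
gapped↔peaked = mk↔ₛ′
  (λ (s , g) → insertPeak s g , insertedPeak s g)
  (λ (s , p) → removePeak p , removedGap p)
  (λ (s , p) → insert∘remove p)
  (λ (s , g) → remove∘insert s g)
  where
  insert∘remove : {s : List Step} (p : PeakAt s) →
    _≡_ {A = Σ (List Step) PeakAt} (insertPeak (removePeak p) (removedGap p) , insertedPeak (removePeak p) (removedGap p)) (s , p)
  insert∘remove here          = refl
  insert∘remove (there {x} p) = cong (λ (s , p) → x ∷ s , there p) (insert∘remove p)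
  remove∘insert : (s : List Step) (g : Gap s) →
    _≡_ {A = Σ (List Step) Gap} (removePeak (insertedPeak s g) , removedGap (insertedPeak s g)) (s , g)
  remove∘insert s       zero    = refl
  remove∘insert (x ∷ s) (suc g) = cong (λ (s , g) → x ∷ s , suc g) (remove∘insert s g)

PeakAt↔Fin-peaks : (s : List Step) → PeakAt s ↔ Fin (peaks s)
PeakAt↔Fin-peaks []          = mk↔ₛ′ (λ ()) (λ ()) (λ ()) (λ ())
PeakAt↔Fin-peaks (u ∷ [])    = mk↔ₛ′ (λ { (there ()) }) (λ ()) (λ ()) (λ { (there ()) })
PeakAt↔Fin-peaks (u ∷ d ∷ s) = ↔-trans split (↔-trans (↔-refl ⊎-cong PeakAt↔Fin-peaks (d ∷ s)) (↔-sym +↔⊎))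
  where
  split : PeakAt (u ∷ d ∷ s) ↔ (Fin 1 ⊎ PeakAt (d ∷ s))
  split = mk↔ₛ′ (λ { here → inj₁ zero ; (there p) → inj₂ p }) (λ { (inj₁ zero) → here ; (inj₂ p) → there p })
                (λ { (inj₁ zero) → refl ; (inj₂ p) → refl }) (λ { here → refl ; (there p) → refl })
PeakAt↔Fin-peaks (u ∷ u ∷ s) = ↔-trans (mk↔ₛ′ (λ { (there p) → p }) there (λ _ → refl) (λ { (there p) → refl }))
                                        (PeakAt↔Fin-peaks (u ∷ s))
PeakAt↔Fin-peaks (d ∷ s)     = ↔-trans (mk↔ₛ′ (λ { (there p) → p }) there (λ _ → refl) (λ { (there p) → refl }))
                                        (PeakAt↔Fin-peaks s)

-- Whether the gap g of s, read after a previous step x, lies between the u and the d of a peak.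
splitsPeak : Step → (s : List Step) → Gap s → Bool
splitsPeak u (d ∷ s) zero    = true
splitsPeak x s       zero    = false
splitsPeak x (y ∷ s) (suc g) = splitsPeak y s g

peaks-insertPeak : (x : Step) (s : List Step) (g : Gap s) →
                   peaks (x ∷ insertPeak s g) ≡ indicator (not (splitsPeak x s g)) + peaks (x ∷ s)
peaks-insertPeak u []      zero    = refl
peaks-insertPeak u (u ∷ s) zero    = refl
peaks-insertPeak u (d ∷ s) zero    = refl
peaks-insertPeak d s       zero    = refl
peaks-insertPeak u (u ∷ s) (suc g) = peaks-insertPeak u s g
peaks-insertPeak u (d ∷ s) (suc g) =
  trans (cong suc (peaks-insertPeak d s g)) (sym (+-suc (indicator (not (splitsPeak d s g))) _))
peaks-insertPeak d (y ∷ s) (suc g) = peaks-insertPeak y s g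

count-splitsPeak : (x : Step) (s : List Step) → count (splitsPeak x s) ≡ peaks (x ∷ s)
count-splitsPeak u []      = refl
count-splitsPeak d []      = refl
count-splitsPeak u (u ∷ s) = count-splitsPeak u s
count-splitsPeak u (d ∷ s) = cong suc (count-splitsPeak d s)
count-splitsPeak d (y ∷ s) = count-splitsPeak y s

length-insertPeak : (s : List Step) (g : Gap s) → length (insertPeak s g) ≡ suc (suc (length s))
length-insertPeak s       zero    = refl
length-insertPeak (x ∷ s) (suc g) = cong suc (length-insertPeak s g)

dyckFrom-insertPeak : (h : ℕ) (s : List Step) (g : Gap s) → dyckFrom h (insertPeak s g) ≡ dyckFrom h s
dyckFrom-insertPeak zero    s       zero    = refl
dyckFrom-insertPeak (suc h) s       zero    = refl
dyckFrom-insertPeak zero    (u ∷ s) (suc g) = dyckFrom-insertPeak 1 s g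
dyckFrom-insertPeak (suc h) (u ∷ s) (suc g) = dyckFrom-insertPeak (suc (suc h)) s g
dyckFrom-insertPeak zero    (d ∷ s) (suc g) = refl
dyckFrom-insertPeak (suc h) (d ∷ s) (suc g) = dyckFrom-insertPeak h s g

-- Counting Dyck paths by peaks

IsDyck : ℕ → ℕ → List Step → Set
IsDyck m k s = (length s ≡ m + m) × (dyckFrom 0 s ≡ true) × (peaks s ≡ k)

Dyck : ℕ → ℕ → Set
Dyck m k = Σ (List Step) (IsDyck m k)

IsDyck-irrelevant : {m k : ℕ} {s : List Step} (p q : IsDyck m k s) → p ≡ q
IsDyck-irrelevant (a , b , c) (a′ , b′ , c′) = cong₂ _,_ (uip a a′) (cong₂ _,_ (uip b b′) (uip c c′))

Step↔Fin2 : Step ↔ Fin 2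
Step↔Fin2 = mk↔ₛ′ (λ { u → zero ; d → suc zero }) (λ { zero → u ; (suc zero) → d })
                  (λ { zero → refl ; (suc zero) → refl }) (λ { u → refl ; d → refl })

balancedWithPeaks? : (k : ℕ) (s : List Step) → Dec ((dyckFrom 0 s ≡ true) × (peaks s ≡ k))
balancedWithPeaks? k s = (dyckFrom 0 s Bool.≟ true) ×-dec (peaks s ≟ k)

-- Only its cardinality matters; keeping the enumeration abstract stops it from ever being unfolded.
abstract
  dyckCount : ℕ → ℕ → ℕ
  dyckCount m k = count (λ i → does (balancedWithPeaks? k (proj₁ (Inverse.from (ListOfLength-finite Step↔Fin2 (m + m)) i))))

  Dyck-finite : (m k : ℕ) → Dyck m k ↔ Fin (dyckCount m k)
  Dyck-finite m k = ↔-trans reassoc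
    (Σ-dec-finite (ListOfLength-finite Step↔Fin2 (m + m)) (λ (s , _) → balancedWithPeaks? k s)
                  (λ _ (a , b) (a′ , b′) → cong₂ _,_ (uip a a′) (uip b b′)))
    where
    reassoc : Dyck m k ↔ Σ (ListOfLength Step (m + m)) (λ (s , _) → (dyckFrom 0 s ≡ true) × (peaks s ≡ k))
    reassoc = mk↔ₛ′ (λ (s , l , p) → (s , l) , p) (λ ((s , l) , p) → s , l , p) (λ _ → refl) (λ _ → refl)

SplittingGap : List Step → Set
SplittingGap s = Σ (Gap s) (λ g → splitsPeak d s g ≡ true)

OtherGap : List Step → Set
OtherGap s = Σ (Gap s) (λ g → splitsPeak d s g ≡ false)

SplittingGap↔Fin-peaks : (s : List Step) → SplittingGap s ↔ Fin (peaks s)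
SplittingGap↔Fin-peaks s = ↔-trans (filter-true-Fin (splitsPeak d s)) (Fin-cong (count-splitsPeak d s))

OtherGap↔Fin : (s : List Step) → OtherGap s ↔ Fin (suc (length s) ∸ peaks s)
OtherGap↔Fin s = ↔-trans (filter-false-Fin (splitsPeak d s)) (Fin-cong (cong (suc (length s) ∸_) (count-splitsPeak d s)))

if-↔ : (b : Bool) {A B : Set} → (if b then A else B) ↔ ((b ≡ true × A) ⊎ (b ≡ false × B))
if-↔ true  = mk↔ₛ′ (λ a → inj₁ (refl , a)) (λ { (inj₁ (_ , a)) → a ; (inj₂ (() , _)) })
                   (λ { (inj₁ (refl , _)) → refl ; (inj₂ (() , _)) }) (λ _ → refl)
if-↔ false = mk↔ₛ′ (λ b → inj₂ (refl , b)) (λ { (inj₁ (() , _)) ; (inj₂ (_ , b)) → b })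
                   (λ { (inj₁ (() , _)) ; (inj₂ (refl , _)) → refl }) (λ _ → refl)

double-injective : (m n : ℕ) → m + m ≡ n + n → m ≡ n
double-injective m n e = trans (n≡⌊n+n/2⌋ m) (trans (cong ⌊_/2⌋ e) (sym (n≡⌊n+n/2⌋ n)))

double-suc : (m n : ℕ) → suc (suc n) ≡ suc m + suc m → n ≡ m + m
double-suc m n eq = suc-injective (trans (suc-injective eq) (+-suc m m))

IsDyck-insertPeak : (m k : ℕ) (s : List Step) (g : Gap s) →
  IsDyck (suc m) (suc k) (insertPeak s g) ↔ (if splitsPeak d s g then IsDyck m (suc k) s else IsDyck m k s)
IsDyck-insertPeak m k s g =
  go (splitsPeak d s g) (length-insertPeak s g) (dyckFrom-insertPeak 0 s g) (peaks-insertPeak d s g)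
  where
  length-↔ : (n : ℕ) → (suc (suc n) ≡ suc m + suc m) ↔ (n ≡ m + m)
  length-↔ n = ≡-↔ (double-suc m n) (λ eq → cong suc (trans (cong suc eq) (sym (+-suc m m))))
  go : (b : Bool) {L L′ P P′ : ℕ} {D D′ : Bool} →
       L′ ≡ suc (suc L) → D′ ≡ D → P′ ≡ indicator (not b) + P →
       ((L′ ≡ suc m + suc m) × (D′ ≡ true) × (P′ ≡ suc k)) ↔
       (if b then (L ≡ m + m) × (D ≡ true) × (P ≡ suc k) else (L ≡ m + m) × (D ≡ true) × (P ≡ k))
  go true  {L} refl refl refl = length-↔ L ×-cong ↔-refl
  go false {L} refl refl refl = length-↔ L ×-cong (↔-refl ×-cong ≡-↔ suc-injective (cong suc))

-- Deleting a marked peak leaves a marked gap of a shorter path; inserting u d there creates a new peak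
-- unless the gap splits an existing one.
peak-insertion : (m k : ℕ) →
  Σ (Dyck (suc m) (suc k)) (λ P → PeakAt (proj₁ P)) ↔
  (Σ (Dyck m (suc k)) (λ P → SplittingGap (proj₁ P)) ⊎ Σ (Dyck m k) (λ P → OtherGap (proj₁ P)))
peak-insertion m k =
  ↔-trans (mk↔ₛ′ (λ ((s , i) , p) → (s , p) , i) (λ ((s , p) , i) → (s , i) , p) (λ _ → refl) (λ _ → refl))
  (↔-trans (↔-sym (Σ-↔ gapped↔peaked ↔-refl))
  (↔-trans (Σ-↔ʳ (λ (s , g) → ↔-trans (IsDyck-insertPeak m k s g) (if-↔ (splitsPeak d s g))))
  (↔-trans Σ-distribˡ-⊎
           (regroup ⊎-cong regroup))))
  where
  regroup : {b : Bool} {P : List Step → Set} →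
    Σ (Σ (List Step) Gap) (λ (s , g) → splitsPeak d s g ≡ b × P s) ↔
    Σ (Σ (List Step) P) (λ (s , _) → Σ (Gap s) (λ g → splitsPeak d s g ≡ b))
  regroup = mk↔ₛ′ (λ ((s , g) , e , p) → (s , p) , g , e) (λ ((s , p) , g , e) → (s , g) , e , p)
                  (λ _ → refl) (λ _ → refl)

dyckCount-recurrence : (m k : ℕ) →
  dyckCount (suc m) (suc k) * suc k ≡ dyckCount m (suc k) * suc k + dyckCount m k * (suc (m + m) ∸ k)
dyckCount-recurrence m k = card-unique
  (Σ-const-fibre (Dyck-finite (suc m) (suc k)) (λ (s , _ , _ , p) → ↔-trans (PeakAt↔Fin-peaks s) (Fin-cong p)))
  (↔-trans (peak-insertion m k) (↔-trans (splitting ⊎-cong other) (↔-sym +↔⊎)))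
  where
  splitting : Σ (Dyck m (suc k)) (λ P → SplittingGap (proj₁ P)) ↔ Fin (dyckCount m (suc k) * suc k)
  splitting = Σ-const-fibre (Dyck-finite m (suc k))
                (λ (s , _ , _ , p) → ↔-trans (SplittingGap↔Fin-peaks s) (Fin-cong p))
  other : Σ (Dyck m k) (λ P → OtherGap (proj₁ P)) ↔ Fin (dyckCount m k * (suc (m + m) ∸ k))
  other = Σ-const-fibre (Dyck-finite m k)
            (λ (s , l , _ , p) → ↔-trans (OtherGap↔Fin s) (Fin-cong (cong₂ (λ n j → suc n ∸ j) l p)))

Dyck-zero : (k : ℕ) → Dyck 0 k ↔ Fin (poly1 k)
Dyck-zero zero    = mk↔ₛ′ (λ _ → zero) (λ _ → [] , refl , refl , refl)
                          (λ { zero → refl }) (λ { ([] , refl , refl , refl) → refl })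
Dyck-zero (suc k) = mk↔ₛ′ (λ { ([] , _ , _ , ()) }) (λ ()) (λ ()) (λ { ([] , _ , _ , ()) })

balanced-nonempty-has-peak : (h : ℕ) (s : List Step) → dyckFrom h (u ∷ s) ≡ true → peaks (u ∷ s) ≡ 0 → ⊥
balanced-nonempty-has-peak zero    []      ()
balanced-nonempty-has-peak (suc h) []      ()
balanced-nonempty-has-peak h       (d ∷ s) _  ()
balanced-nonempty-has-peak zero    (u ∷ s) b  p = balanced-nonempty-has-peak 1 s b p
balanced-nonempty-has-peak (suc h) (u ∷ s) b  p = balanced-nonempty-has-peak (suc (suc h)) s b p

Dyck-suc-zero : (m : ℕ) → Dyck (suc m) 0 ↔ Fin 0
Dyck-suc-zero m = mk↔ₛ′ (λ P → ⊥-elim (no-peak P)) (λ ()) (λ ()) (λ P → ⊥-elim (no-peak P))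
  where
  no-peak : Dyck (suc m) 0 → ⊥
  no-peak ([]    , () , _)
  no-peak (d ∷ s , _ , () , _)
  no-peak (u ∷ s , _ , b , p) = balanced-nonempty-has-peak 0 s b p

dyckCount-zero : (k : ℕ) → dyckCount 0 k ≡ poly1 k
dyckCount-zero k = card-unique (Dyck-finite 0 k) (Dyck-zero k)

dyckCount-suc-zero : (m : ℕ) → dyckCount (suc m) 0 ≡ 0
dyckCount-suc-zero m = card-unique (Dyck-finite (suc m) 0) (Dyck-suc-zero m)

pascal : (n k : ℕ) → suc n C suc k ≡ n C k + n C suc k
pascal n k = sym (nCk+nC[k+1]≡[n+1]C[k+1] n k)

absorption : (n k : ℕ) → suc k * (suc n C suc k) ≡ suc n * (n C k)
absorption n       zero    = trans (+-identityʳ _) (trans (nC1≡n (suc n)) (sym (*-identityʳ (suc n))))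
absorption zero    (suc k) = *-zeroʳ (suc (suc k))
absorption (suc n) (suc k) = begin
  suc (suc k) * (suc (suc n) C suc (suc k))
    ≡⟨ cong (suc (suc k) *_) (pascal (suc n) (suc k)) ⟩
  suc (suc k) * (x + y)
    ≡⟨ split-factor k x y ⟩
  x + suc k * x + suc (suc k) * y
    ≡⟨ cong₂ (λ p q → x + p + q) (absorption n k) (absorption n (suc k)) ⟩
  x + suc n * (n C k) + suc n * (n C suc k)
    ≡⟨ cong (λ x → x + suc n * (n C k) + suc n * (n C suc k)) (pascal n k) ⟩
  (n C k + n C suc k) + suc n * (n C k) + suc n * (n C suc k)
    ≡⟨ collect-factor n (n C k) (n C suc k) ⟩
  suc (suc n) * (n C k + n C suc k)
    ≡⟨ cong (suc (suc n) *_) (pascal n k) ⟨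
  suc (suc n) * x
    ∎
  where
  open ≡-Reasoning
  x y : ℕ
  x = suc n C suc k
  y = suc n C suc (suc k)
  split-factor : ∀ k x y → suc (suc k) * (x + y) ≡ x + suc k * x + suc (suc k) * y
  split-factor = solve-∀
  collect-factor : ∀ n x y → (x + y) + suc n * x + suc n * y ≡ suc (suc n) * (x + y)
  collect-factor = solve-∀

C-ratio : (i r : ℕ) → suc i * ((i + r) C suc i) ≡ r * ((i + r) C i)
C-ratio i r = +-cancelˡ-≡ (suc i * c) _ _ (begin
  suc i * c + suc i * a    ≡⟨ *-distribˡ-+ (suc i) c a ⟨
  suc i * (c + a)          ≡⟨ cong (suc i *_) (pascal (i + r) i) ⟨
  suc i * (suc (i + r) C suc i) ≡⟨ absorption (i + r) i ⟩
  suc (i + r) * c          ≡⟨ *-distribʳ-+ c (suc i) r ⟩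
  suc i * c + r * c        ∎)
  where
  open ≡-Reasoning
  a c : ℕ
  a = (i + r) C suc i
  c = (i + r) C i

-- n C (i ∸ 1), except that it vanishes at i = 0
lowerC : ℕ → ℕ → ℕ
lowerC n zero    = 0
lowerC n (suc i) = n C i

pascal-lower : (n i : ℕ) → suc n C i ≡ lowerC n i + n C i
pascal-lower n zero    = refl
pascal-lower n (suc i) = pascal n i

C-ratio-lower : (i r : ℕ) → i * ((i + r) C i) ≡ suc r * lowerC (i + r) i
C-ratio-lower zero    r = sym (*-zeroʳ (suc r))
C-ratio-lower (suc j) r =
  subst (λ n → suc j * (n C suc j) ≡ suc r * (n C j)) (+-suc j r) (C-ratio j (suc r))

-- Here a, b, c stand for C(i+r, i+1), C(i+r, i−1), C(i+r, i). Multiplying by (i+1)(r+1) and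
-- substituting the two ratios leaves a polynomial identity.
narayana-identity : ∀ i r a b c → suc i * a ≡ r * c → i * c ≡ suc r * b →
  suc (i + r) * (suc i * a * c + suc (r + (i + r)) * c * b) ≡ suc i * (i + r) * ((c + a) * (b + c))
narayana-identity i r a b c a-ratio b-ratio = *-cancelˡ-≡ _ _ (suc i * suc r) (begin
  (suc i * suc r) * (suc (i + r) * (suc i * a * c + K * c * b))
    ≡⟨ expand i r a b c ⟩
  suc (i + r) * (suc r * suc i * (suc i * a) * c + K * suc i * c * (suc r * b))
    ≡⟨ cong₂ (λ x y → suc (i + r) * (suc r * suc i * x * c + K * suc i * c * y)) a-ratio (sym b-ratio) ⟩
  suc (i + r) * (suc r * suc i * (r * c) * c + K * suc i * c * (i * c))
    ≡⟨ in-c i r c ⟩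
  suc i * (i + r) * ((r * c + suc i * c) * (suc r * c + i * c))
    ≡⟨ cong₂ (λ x y → suc i * (i + r) * ((x + suc i * c) * (suc r * c + y))) (sym a-ratio) b-ratio ⟩
  suc i * (i + r) * ((suc i * a + suc i * c) * (suc r * c + suc r * b))
    ≡⟨ factor i r a b c ⟩
  (suc i * suc r) * (suc i * (i + r) * ((c + a) * (b + c)))
    ∎)
  where
  open ≡-Reasoning
  K : ℕ
  K = suc (r + (i + r))
  expand : ∀ i r a b c →
    (suc i * suc r) * (suc (i + r) * (suc i * a * c + suc (r + (i + r)) * c * b)) ≡
    suc (i + r) * (suc r * suc i * (suc i * a) * c + suc (r + (i + r)) * suc i * c * (suc r * b))
  expand = solve-∀
  in-c : ∀ i r c →
    suc (i + r) * (suc r * suc i * (r * c) * c + suc (r + (i + r)) * suc i * c * (i * c)) ≡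
    suc i * (i + r) * ((r * c + suc i * c) * (suc r * c + i * c))
  in-c = solve-∀
  factor : ∀ i r a b c →
    suc i * (i + r) * ((suc i * a + suc i * c) * (suc r * c + suc r * b)) ≡
    (suc i * suc r) * (suc i * (i + r) * ((c + a) * (b + c)))
  factor = solve-∀

narayana-key : (n i : ℕ) →
  suc n * (suc i * (n C suc i) * (n C i) + (suc (n + n) ∸ i) * (n C i) * lowerC n i) ≡
  suc i * n * ((n C i + n C suc i) * (lowerC n i + n C i))
narayana-key n i with i ≤? n
... | yes i≤n with m≤n⇒∃[o]m+o≡n i≤n
...   | r , refl = trans (cong (λ K → suc (i + r) * (suc i * a * c + K * c * b)) K≡)
                         (narayana-identity i r a b c (C-ratio i r) (C-ratio-lower i r))
  where
  a b c : ℕ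
  a = (i + r) C suc i
  b = lowerC (i + r) i
  c = (i + r) C i
  K≡ : suc ((i + r) + (i + r)) ∸ i ≡ suc (r + (i + r))
  K≡ = trans (cong (_∸ i) (shuffle i r)) (m+n∸m≡n i _)
    where
    shuffle : ∀ i r → suc ((i + r) + (i + r)) ≡ i + suc (r + (i + r))
    shuffle = solve-∀
narayana-key n i | no i≰n
  rewrite k>n⇒nCk≡0 (≰⇒> i≰n) | k>n⇒nCk≡0 (m<n⇒m<1+n (≰⇒> i≰n)) = both-zero n i (suc (n + n) ∸ i) (lowerC n i)
  where
  both-zero : ∀ n i K b → suc n * (suc i * 0 * 0 + K * 0 * b) ≡ suc i * n * ((0 + 0) * (b + 0))
  both-zero = solve-∀

ClosedForm : ℕ → Set
ClosedForm n = (i : ℕ) → n * dyckCount n (suc i) ≡ (n C suc i) * (n C i)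

dyckCount-closed-one : ClosedForm 1
dyckCount-closed-one i = from-recurrence i (dyckCount-recurrence 0 i)
  where
  from-recurrence : (i : ℕ) →
    dyckCount 1 (suc i) * suc i ≡ dyckCount 0 (suc i) * suc i + dyckCount 0 i * (1 ∸ i) →
    1 * dyckCount 1 (suc i) ≡ (1 C suc i) * (1 C i)
  from-recurrence zero    rec rewrite dyckCount-zero 1 | dyckCount-zero 0 =
    trans (+-identityʳ _) (trans (sym (*-identityʳ _)) rec)
  from-recurrence (suc j) rec rewrite dyckCount-zero (suc (suc j)) | dyckCount-zero (suc j) =
    trans (+-identityʳ _) (m*n≡0⇒m≡0 _ (suc (suc j)) rec)

-- Multiplying the claim for n + 1 by (i + 1) n turns it into the recurrence combined with the claim for n.
dyckCount-closed-suc : (n : ℕ) → ClosedForm (suc n) → ClosedForm (suc (suc n))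
dyckCount-closed-suc n closed i = *-cancelˡ-≡ _ _ (suc i * N) (begin
  (suc i * N) * (suc N * X)
    ≡⟨ reorder i N X ⟩
  suc N * (N * (X * suc i))
    ≡⟨ cong (λ z → suc N * (N * z)) (dyckCount-recurrence N i) ⟩
  suc N * (N * (dyckCount N (suc i) * suc i + dyckCount N i * K))
    ≡⟨ distribute N (dyckCount N (suc i)) (dyckCount N i) i K ⟩
  suc N * ((N * dyckCount N (suc i)) * suc i + (N * dyckCount N i) * K)
    ≡⟨ cong₂ (λ x y → suc N * (x * suc i + y * K)) (closed i) (closed-lower i) ⟩
  suc N * ((a * c) * suc i + (c * b) * K)
    ≡⟨ rearrange N a c b i K ⟩
  suc N * (suc i * a * c + K * c * b)
    ≡⟨ narayana-key N i ⟩
  suc i * N * ((c + a) * (b + c))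
    ≡⟨ cong₂ (λ x y → suc i * N * (x * y)) (pascal N i) (pascal-lower N i) ⟨
  suc i * N * ((suc N C suc i) * (suc N C i))
    ∎)
  where
  open ≡-Reasoning
  N X K a b c : ℕ
  N = suc n
  X = dyckCount (suc N) (suc i)
  K = suc (N + N) ∸ i
  a = N C suc i
  b = lowerC N i
  c = N C i
  closed-lower : (i : ℕ) → N * dyckCount N i ≡ (N C i) * lowerC N i
  closed-lower zero    = trans (cong (N *_) (dyckCount-suc-zero n)) (*-zeroʳ N)
  closed-lower (suc i) = closed i
  reorder : ∀ i N X → (suc i * N) * (suc N * X) ≡ suc N * (N * (X * suc i))
  reorder = solve-∀
  distribute : ∀ N f g i K → suc N * (N * (f * suc i + g * K)) ≡ suc N * ((N * f) * suc i + (N * g) * K)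
  distribute = solve-∀
  rearrange : ∀ N a c b i K → suc N * ((a * c) * suc i + (c * b) * K) ≡ suc N * (suc i * a * c + K * c * b)
  rearrange = solve-∀

dyckCount-closed : (n : ℕ) → ClosedForm (suc n)
dyckCount-closed zero    = dyckCount-closed-one
dyckCount-closed (suc n) = dyckCount-closed-suc n (dyckCount-closed n)

dyckCount≡narayana : (m k : ℕ) → dyckCount m k ≡ narayanaPoly m k
dyckCount≡narayana zero    k       = dyckCount-zero k
dyckCount≡narayana (suc m) zero    = dyckCount-suc-zero m
dyckCount≡narayana (suc m) (suc i) = sym (begin
  ((suc m C suc i) * (suc m C i)) / suc m ≡⟨ cong (_/ suc m) (dyckCount-closed m i) ⟨
  (suc m * F) / suc m                     ≡⟨ cong (_/ suc m) (*-comm (suc m) F) ⟩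
  (F * suc m) / suc m                     ≡⟨ m*n/n≡m F (suc m) ⟩
  F                                       ∎)
  where
  open ≡-Reasoning
  F : ℕ
  F = dyckCount (suc m) (suc i)

Dyck↔Fin-narayana : (m k : ℕ) → Dyck m k ↔ Fin (narayanaPoly m k)
Dyck↔Fin-narayana m k = ↔-trans (Dyck-finite m k) (Fin-cong (dyckCount≡narayana m k))

-- Dyck paths as plane forests

-- cons f g is the forest whose first tree has the subtrees f and which continues with g.
data Forest : Set where
  nil  : Forest
  cons : Forest → Forest → Forest

encode : Forest → List Step
encode nil        = []
encode (cons f g) = u ∷ (encode f ++ d ∷ encode g)

size : Forest → ℕ
size nil        = 0
size (cons f g) = suc (size f + size g)

leaves : Forest → ℕ
leaves nil                 = 0
leaves (cons nil g)        = suc (leaves g)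
leaves (cons (cons a b) g) = leaves (cons a b) + leaves g

startsWithLeaf : Forest → Bool
startsWithLeaf (cons nil _) = true
startsWithLeaf _            = false

length-encode : (f : Forest) → length (encode f) ≡ size f + size f
length-encode nil        = refl
length-encode (cons f g) = begin
  suc (length (encode f ++ d ∷ encode g))     ≡⟨ cong suc (length-++ (encode f)) ⟩
  suc (length (encode f) + suc (length (encode g)))
    ≡⟨ cong₂ (λ x y → suc (x + suc y)) (length-encode f) (length-encode g) ⟩
  suc ((size f + size f) + suc (size g + size g)) ≡⟨ regroup (size f) (size g) ⟩
  suc (size f + size g) + suc (size f + size g) ∎
  where
  open ≡-Reasoning
  regroup : ∀ a b → suc ((a + a) + suc (b + b)) ≡ suc (a + b) + suc (a + b)
  regroup = solve-∀

dyckFrom-u : (h : ℕ) (s : List Step) → dyckFrom h (u ∷ s) ≡ dyckFrom (suc h) s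
dyckFrom-u zero    s = refl
dyckFrom-u (suc h) s = refl

dyckFrom-++ : (j h : ℕ) (A B : List Step) → dyckFrom j A ≡ true → dyckFrom (j + h) (A ++ B) ≡ dyckFrom h B
dyckFrom-++ zero    h []      B _ = refl
dyckFrom-++ (suc j) h []      B ()
dyckFrom-++ j       h (u ∷ A) B e =
  trans (dyckFrom-u (j + h) (A ++ B)) (dyckFrom-++ (suc j) h A B (trans (sym (dyckFrom-u j A)) e))
dyckFrom-++ zero    h (d ∷ A) B ()
dyckFrom-++ (suc j) h (d ∷ A) B e = dyckFrom-++ j h A B e

dyckFrom-encode : (f : Forest) → dyckFrom 0 (encode f) ≡ true
dyckFrom-encode nil        = refl
dyckFrom-encode (cons f g) = trans (dyckFrom-++ 0 1 (encode f) (d ∷ encode g) (dyckFrom-encode f)) (dyckFrom-encode g)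

first-descent-unique : (j : ℕ) (A A′ B B′ : List Step) → dyckFrom j A ≡ true → dyckFrom j A′ ≡ true →
                       A ++ d ∷ B ≡ A′ ++ d ∷ B′ → A ≡ A′ × B ≡ B′
first-descent-unique zero    []      []       B B′ _ _  e = refl , ∷-injectiveʳ e
first-descent-unique zero    []      (u ∷ A′) B B′ _ _  ()
first-descent-unique zero    []      (d ∷ A′) B B′ _ () _
first-descent-unique zero    (u ∷ A) []       B B′ _ _  ()
first-descent-unique zero    (d ∷ A) A′       B B′ () _ _
first-descent-unique zero    (u ∷ A) (d ∷ A′) B B′ _ () _
first-descent-unique zero    (u ∷ A) (u ∷ A′) B B′ b b′ e
  with first-descent-unique 1 A A′ B B′ b b′ (∷-injectiveʳ e)
... | refl , refl = refl , refl
first-descent-unique (suc j) []      A′       B B′ () _ _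
first-descent-unique (suc j) (x ∷ A) []       B B′ _ () _
first-descent-unique (suc j) (u ∷ A) (d ∷ A′) B B′ _ _  ()
first-descent-unique (suc j) (d ∷ A) (u ∷ A′) B B′ _ _  ()
first-descent-unique (suc j) (u ∷ A) (u ∷ A′) B B′ b b′ e
  with first-descent-unique (suc (suc j)) A A′ B B′ b b′ (∷-injectiveʳ e)
... | refl , refl = refl , refl
first-descent-unique (suc j) (d ∷ A) (d ∷ A′) B B′ b b′ e
  with first-descent-unique j A A′ B B′ b b′ (∷-injectiveʳ e)
... | refl , refl = refl , refl

encode-injective : (f g : Forest) → encode f ≡ encode g → f ≡ g
encode-injective nil        nil          _ = refl
encode-injective (cons f g) (cons f′ g′) e
  with first-descent-unique 0 (encode f) (encode f′) (encode g) (encode g′)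
         (dyckFrom-encode f) (dyckFrom-encode f′) (∷-injectiveʳ e)
... | f≡f′ , g≡g′ = cong₂ cons (encode-injective f f′ f≡f′) (encode-injective g g′ g≡g′)

first-descent : (c e : ℕ) (s : List Step) → dyckFrom (suc (c + e)) s ≡ true →
  Σ (List Step × List Step) (λ (A , B) → (s ≡ A ++ d ∷ B) × (dyckFrom c A ≡ true) × (dyckFrom e B ≡ true))
first-descent c       e (u ∷ s) b with first-descent (suc c) e s b
... | (A , B) , refl , bA , bB = (u ∷ A , B) , refl , trans (dyckFrom-u c A) bA , bB
first-descent zero    e (d ∷ s) b = ([] , s) , refl , refl , b
first-descent (suc c) e (d ∷ s) b with first-descent c e s b
... | (A , B) , refl , bA , bB = (d ∷ A , B) , refl , bA , bB

decode : (fuel : ℕ) (s : List Step) → length s ≤ fuel → dyckFrom 0 s ≡ true → Σ Forest (λ f → encode f ≡ s)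
decode fuel       []      _       _ = nil , refl
decode (suc fuel) (u ∷ s) (s≤s l) b with first-descent 0 0 s b
... | (A , B) , refl , bA , bB with decode fuel A lA bA | decode fuel B lB bB
  where
  length-s : length (A ++ d ∷ B) ≡ length A + suc (length B)
  length-s = length-++ A
  lA : length A ≤ fuel
  lA = ≤-trans (m≤m+n _ _) (subst (_≤ fuel) length-s l)
  lB : length B ≤ fuel
  lB = ≤-trans (≤-trans (n≤1+n _) (m≤n+m _ _)) (subst (_≤ fuel) length-s l)
... | f , refl | g , refl = cons f g , refl

Balanced : Set
Balanced = Σ (List Step) (λ s → dyckFrom 0 s ≡ true)

Forest↔Balanced : Forest ↔ Balanced
Forest↔Balanced = mk↔ₛ′ (λ f → encode f , dyckFrom-encode f) (λ (s , b) → proj₁ (dec s b))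
  (λ (s , b) → balanced-≡ (proj₂ (dec s b)))
  (λ f → encode-injective _ f (proj₂ (dec (encode f) (dyckFrom-encode f))))
  where
  dec : (s : List Step) → dyckFrom 0 s ≡ true → Σ Forest (λ f → encode f ≡ s)
  dec s = decode (length s) s ≤-refl
  balanced-≡ : {s s′ : List Step} {b : dyckFrom 0 s ≡ true} {b′ : dyckFrom 0 s′ ≡ true} →
               s ≡ s′ → _≡_ {A = Balanced} (s , b) (s′ , b′)
  balanced-≡ {s} {b = b} {b′} refl = cong (s ,_) (uip b b′)

peaks-++-d : (A B : List Step) → peaks (A ++ d ∷ B) ≡ peaks (A ++ d ∷ []) + peaks B
peaks-++-d []          B = refl
peaks-++-d (d ∷ A)     B = peaks-++-d A B
peaks-++-d (u ∷ [])    B = refl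
peaks-++-d (u ∷ u ∷ A) B = peaks-++-d (u ∷ A) B
peaks-++-d (u ∷ d ∷ A) B = cong suc (peaks-++-d A B)

leaves-cons : (f g : Forest) → leaves (cons f nil) + leaves g ≡ leaves (cons f g)
leaves-cons nil        g = refl
leaves-cons (cons a b) g = cong (_+ leaves g) (+-identityʳ (leaves (cons a b)))

peaks-encode-++-d : (f : Forest) (B : List Step) → peaks (encode f ++ d ∷ B) ≡ leaves f + peaks B
peaks-first-tree : (f : Forest) → peaks (u ∷ encode f ++ d ∷ []) ≡ leaves (cons f nil)

peaks-encode-++-d nil        B = refl
peaks-encode-++-d (cons f g) B = begin
  peaks (u ∷ (encode f ++ d ∷ encode g) ++ d ∷ B)
    ≡⟨ cong (λ s → peaks (u ∷ s)) (++-assoc (encode f) (d ∷ encode g) (d ∷ B)) ⟩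
  peaks (u ∷ encode f ++ d ∷ (encode g ++ d ∷ B))
    ≡⟨ peaks-++-d (u ∷ encode f) (encode g ++ d ∷ B) ⟩
  peaks (u ∷ encode f ++ d ∷ []) + peaks (encode g ++ d ∷ B)
    ≡⟨ cong₂ _+_ (peaks-first-tree f) (peaks-encode-++-d g B) ⟩
  leaves (cons f nil) + (leaves g + peaks B)
    ≡⟨ +-assoc (leaves (cons f nil)) (leaves g) (peaks B) ⟨
  leaves (cons f nil) + leaves g + peaks B
    ≡⟨ cong (_+ peaks B) (leaves-cons f g) ⟩
  leaves (cons f g) + peaks B
    ∎
  where open ≡-Reasoning

peaks-first-tree nil        = refl
peaks-first-tree (cons a b) = peaks-encode-++-d (cons a b) []

peaks-encode : (f : Forest) → peaks (encode f) ≡ leaves f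
peaks-encode nil        = refl
peaks-encode (cons f g) =
  trans (peaks-++-d (u ∷ encode f) (encode g))
        (trans (cong₂ _+_ (peaks-first-tree f) (peaks-encode g)) (leaves-cons f g))

startsUD-encode : (f : Forest) → startsUD (encode f) ≡ startsWithLeaf f
startsUD-encode nil                 = refl
startsUD-encode (cons nil g)        = refl
startsUD-encode (cons (cons a b) g) = refl

-- Blocks, and the decomposition of U

NonEmptyDyck : Set
NonEmptyDyck = Σ ℕ (λ m → Σ ℕ (Dyck (suc m)))

NonEmptyDyck-≡ : {x y : NonEmptyDyck} → proj₁ (proj₂ (proj₂ x)) ≡ proj₁ (proj₂ (proj₂ y)) → x ≡ y
NonEmptyDyck-≡ {m , k , s , l , b , p} {m′ , k′ , .s , l′ , b′ , p′} refl
  with double-injective (suc m) (suc m′) (trans (sym l) l′) | trans (sym p) p′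
... | refl | refl =
  cong (λ q → m , k , s , q) (IsDyck-irrelevant {suc m} {k} {s} (l , b , p) (l′ , b′ , p′))

-- The junk value at nil is never used: the forests below come from non-empty words.
children : Forest → Forest × Forest
children nil        = nil , nil
children (cons a b) = a , b

Pairs↔NonEmptyDyck : (Forest × Forest) ↔ NonEmptyDyck
Pairs↔NonEmptyDyck = mk↔ₛ′ to from
  (λ (m , k , s , l , b , p) → to∘children (Inverse.from Forest↔Balanced (s , b))
      (cong proj₁ (Inverse.strictlyInverseˡ Forest↔Balanced (s , b))) l)
  from∘to
  where
  to : Forest × Forest → NonEmptyDyck
  to (a , b) = size a + size b , leaves (cons a b) , encode (cons a b) ,
               length-encode (cons a b) , dyckFrom-encode (cons a b) , peaks-encode (cons a b)
  from : NonEmptyDyck → Forest × Forest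
  from (_ , _ , s , _ , b , _) = children (Inverse.from Forest↔Balanced (s , b))
  from∘to : (p : Forest × Forest) → from (to p) ≡ p
  from∘to (a , b) = cong children (Inverse.strictlyInverseʳ Forest↔Balanced (cons a b))
  to∘children : (f : Forest) {m k : ℕ} {P : Dyck (suc m) k} → encode f ≡ proj₁ P →
                length (proj₁ P) ≡ suc m + suc m → to (children f) ≡ (m , k , P)
  to∘children nil        refl ()
  to∘children (cons a b) e    _ = NonEmptyDyck-≡ e

Block : Set
Block = NonEmptyDyck × ℕ

-- ((m , k , P) , ℓ) stands for the word u P d (u d)^ℓ.
Blockᵍ : Graded
Blockᵍ = graded Block (λ ((m , k , _) , ℓ) → suc (suc m) + ℓ , k + ℓ)

Uᵍ : Graded
Uᵍ = graded (Σ ℕ UCopies) (λ (n , c) → n , degree c)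

UPathᵍ : Graded
UPathᵍ = graded (Σ ℕ UPath) (λ (n , P) → n , peaks (steps (path P)))

Uᵍ≅UPathᵍ : Uᵍ ≅ UPathᵍ
Uᵍ≅UPathᵍ = mk≅
  (mk↔ₛ′ (λ (n , P , _) → n , P) (λ (n , P) → n , P , Inverse.from (Term-tPow (peaks (steps (path P)))) tt)
         (λ _ → refl)
         (λ (n , P , t) → cong (λ t → n , P , t) (Inverse.strictlyInverseʳ (Term-tPow (peaks (steps (path P)))) t)))
  (λ (n , P , t) → cong (n ,_) (sym (degree-tPow _ t)))

UPath-≡ : {x y : Σ ℕ UPath} → steps (path (proj₂ x)) ≡ steps (path (proj₂ y)) → x ≡ y
UPath-≡ {n , mkU (mkDyck s l b) nu} {n′ , mkU (mkDyck .s l′ b′) nu′} refl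
  with double-injective n n′ (trans (sym l) l′)
... | refl rewrite uip l l′ | uip b b′ | uip nu nu′ = refl

forestGrade : Forest → ℕ × ℕ
forestGrade f = size f , leaves f

LeafFreeStart : Set
LeafFreeStart = Σ Forest (λ f → startsWithLeaf f ≡ false)

LeafFreeStart-≡ : {x y : LeafFreeStart} → proj₁ x ≡ proj₁ y → x ≡ y
LeafFreeStart-≡ {f , ok} {.f , ok′} refl = cong (f ,_) (uip ok ok′)

LeafFreeStartᵍ : Graded
LeafFreeStartᵍ = graded LeafFreeStart (λ (f , _) → forestGrade f)

LeafFreeStartᵍ≅UPathᵍ : LeafFreeStartᵍ ≅ UPathᵍ
LeafFreeStartᵍ≅UPathᵍ = mk≅ (mk↔ₛ′ to from to∘from from∘to) (λ (f , _) → cong (size f ,_) (peaks-encode f))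
  where
  to : LeafFreeStart → Σ ℕ UPath
  to (f , ok) = size f , mkU (mkDyck (encode f) (length-encode f) (dyckFrom-encode f)) (trans (startsUD-encode f) ok)
  decoded : (s : List Step) (b : dyckFrom 0 s ≡ true) → encode (Inverse.from Forest↔Balanced (s , b)) ≡ s
  decoded s b = cong proj₁ (Inverse.strictlyInverseˡ Forest↔Balanced (s , b))
  from : Σ ℕ UPath → LeafFreeStart
  from (_ , mkU (mkDyck s _ b) nu) = let f = Inverse.from Forest↔Balanced (s , b) in
    f , trans (sym (startsUD-encode f)) (trans (cong startsUD (decoded s b)) nu)
  to∘from : ∀ x → to (from x) ≡ x
  to∘from (_ , mkU (mkDyck s _ b) _) = UPath-≡ (decoded s b)
  from∘to : ∀ x → from (to x) ≡ x
  from∘to (f , ok) = LeafFreeStart-≡ (Inverse.strictlyInverseʳ Forest↔Balanced f)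

-- (a , b , ℓ) stands for the tree with subtrees cons a b followed by ℓ leaves.
TreeRun : Set
TreeRun = Forest × Forest × ℕ

TreeRunᵍ : Graded
TreeRunᵍ = graded TreeRun (λ (a , b , ℓ) → (suc (size (cons a b)) , leaves (cons a b)) ⊕ (ℓ , ℓ))

leavesThen : ℕ → Forest → Forest
leavesThen zero    f = f
leavesThen (suc ℓ) f = cons nil (leavesThen ℓ f)

leavesThen-suc : (ℓ : ℕ) (f : Forest) → leavesThen (suc ℓ) f ≡ leavesThen ℓ (cons nil f)
leavesThen-suc zero    f = refl
leavesThen-suc (suc ℓ) f = cong (cons nil) (leavesThen-suc ℓ f)

forestGrade-leavesThen : (ℓ : ℕ) (f : Forest) → forestGrade (leavesThen ℓ f) ≡ (ℓ , ℓ) ⊕ forestGrade f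
forestGrade-leavesThen zero    f = refl
forestGrade-leavesThen (suc ℓ) f = cong ((1 , 1) ⊕_) (forestGrade-leavesThen ℓ f)

fromRuns : List TreeRun → Forest
fromRuns []                 = nil
fromRuns ((a , b , ℓ) ∷ rs) = cons (cons a b) (leavesThen ℓ (fromRuns rs))

-- The runs of cons (cons a b) (leavesThen ℓ f)
runsFrom : Forest → Forest → ℕ → Forest → List TreeRun
runsFrom a b ℓ nil                   = (a , b , ℓ) ∷ []
runsFrom a b ℓ (cons nil f)          = runsFrom a b (suc ℓ) f
runsFrom a b ℓ (cons (cons a′ b′) f) = (a , b , ℓ) ∷ runsFrom a′ b′ 0 f

toRuns : (f : Forest) → startsWithLeaf f ≡ false → List TreeRun
toRuns nil                 _ = []
toRuns (cons (cons a b) f) _ = runsFrom a b 0 f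

fromRuns-runsFrom : (a b : Forest) (ℓ : ℕ) (f : Forest) → fromRuns (runsFrom a b ℓ f) ≡ cons (cons a b) (leavesThen ℓ f)
fromRuns-runsFrom a b ℓ nil                   = refl
fromRuns-runsFrom a b ℓ (cons nil f)          =
  trans (fromRuns-runsFrom a b (suc ℓ) f) (cong (cons (cons a b)) (leavesThen-suc ℓ f))
fromRuns-runsFrom a b ℓ (cons (cons a′ b′) f) = cong (λ g → cons (cons a b) (leavesThen ℓ g)) (fromRuns-runsFrom a′ b′ 0 f)

runsFrom-fromRuns : (a b : Forest) (ℓ ℓ′ : ℕ) (rs : List TreeRun) →
                    runsFrom a b ℓ (leavesThen ℓ′ (fromRuns rs)) ≡ (a , b , ℓ + ℓ′) ∷ rs
runsFrom-fromRuns a b ℓ zero     []                    = cong (λ ℓ → (a , b , ℓ) ∷ []) (sym (+-identityʳ ℓ))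
runsFrom-fromRuns a b ℓ zero     ((a′ , b′ , ℓ′) ∷ rs) =
  cong₂ (λ ℓ rs → (a , b , ℓ) ∷ rs) (sym (+-identityʳ ℓ)) (runsFrom-fromRuns a′ b′ 0 ℓ′ rs)
runsFrom-fromRuns a b ℓ (suc ℓ′) rs                    =
  trans (runsFrom-fromRuns a b (suc ℓ) ℓ′ rs) (cong (λ ℓ → (a , b , ℓ) ∷ rs) (sym (+-suc ℓ ℓ′)))

forestGrade-fromRuns : (rs : List TreeRun) → forestGrade (fromRuns rs) ≡ gradeSum (grade TreeRunᵍ) rs
forestGrade-fromRuns []                 = refl
forestGrade-fromRuns ((a , b , ℓ) ∷ rs) =
  trans (cong (first ⊕_) (trans (forestGrade-leavesThen ℓ _) (cong ((ℓ , ℓ) ⊕_) (forestGrade-fromRuns rs))))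
        (sym (⊕-assoc first (ℓ , ℓ) _))
  where
  first : ℕ × ℕ
  first = suc (size (cons a b)) , leaves (cons a b)

TreeRuns≅LeafFreeStart : Listᵍ TreeRunᵍ ≅ LeafFreeStartᵍ
TreeRuns≅LeafFreeStart = mk≅ (mk↔ₛ′ (λ rs → fromRuns rs , startsWithLeaf-fromRuns rs) (λ (f , ok) → toRuns f ok)
                                     fromRuns∘toRuns toRuns∘fromRuns)
                              forestGrade-fromRuns
  where
  startsWithLeaf-fromRuns : (rs : List TreeRun) → startsWithLeaf (fromRuns rs) ≡ false
  startsWithLeaf-fromRuns []      = refl
  startsWithLeaf-fromRuns (_ ∷ _) = refl
  fromRuns∘toRuns : (x : LeafFreeStart) → (fromRuns (toRuns (proj₁ x) (proj₂ x)) , _) ≡ x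
  fromRuns∘toRuns (nil , refl)              = refl
  fromRuns∘toRuns (cons (cons a b) f , ok) = LeafFreeStart-≡ (fromRuns-runsFrom a b 0 f)
  toRuns∘fromRuns : (rs : List TreeRun) → toRuns (fromRuns rs) (startsWithLeaf-fromRuns rs) ≡ rs
  toRuns∘fromRuns []                 = refl
  toRuns∘fromRuns ((a , b , ℓ) ∷ rs) = runsFrom-fromRuns a b 0 ℓ rs

TreeRunᵍ≅Blockᵍ : TreeRunᵍ ≅ Blockᵍ
TreeRunᵍ≅Blockᵍ = mk≅ (mk↔ₛ′ (λ (a , b , ℓ) → Inverse.to Pairs↔NonEmptyDyck (a , b) , ℓ)
                              (λ (P , ℓ) → let (a , b) = Inverse.from Pairs↔NonEmptyDyck P in a , b , ℓ)
                              (λ (P , ℓ) → cong (_, ℓ) (Inverse.strictlyInverseˡ Pairs↔NonEmptyDyck P))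
                              (λ (a , b , ℓ) → cong (λ (a , b) → a , b , ℓ)
                                                     (Inverse.strictlyInverseʳ Pairs↔NonEmptyDyck (a , b))))
                      (λ _ → refl)

Uᵍ≅Blocks : Uᵍ ≅ Listᵍ Blockᵍ
Uᵍ≅Blocks = ≅-trans Uᵍ≅UPathᵍ (≅-trans (≅-sym LeafFreeStartᵍ≅UPathᵍ)
              (≅-trans (≅-sym TreeRuns≅LeafFreeStart) (List-≅ TreeRunᵍ≅Blockᵍ)))

-- The decomposition of V

length-concatMap : (f : A → List Step) (size : A → ℕ) → (∀ x → length (f x) ≡ size x + size x) →
                   (xs : List A) → length (concatMap f xs) ≡ sum (map size xs) + sum (map size xs)
length-concatMap f size length-f []       = refl
length-concatMap f size length-f (x ∷ xs) = begin
  length (f x ++ concatMap f xs)                       ≡⟨ length-++ (f x) ⟩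
  length (f x) + length (concatMap f xs)               ≡⟨ cong₂ _+_ (length-f x) (length-concatMap f size length-f xs) ⟩
  (size x + size x) + (sum (map size xs) + sum (map size xs)) ≡⟨ interchange (size x) (sum (map size xs)) ⟩
  (size x + sum (map size xs)) + (size x + sum (map size xs)) ∎
  where
  open ≡-Reasoning
  interchange : ∀ a b → (a + a) + (b + b) ≡ (a + b) + (a + b)
  interchange = solve-∀

dyckFrom-concatMap : (f : A → List Step) → (∀ x → dyckFrom 0 (f x) ≡ true) →
                     (xs : List A) → dyckFrom 0 (concatMap f xs) ≡ true
dyckFrom-concatMap f bal []       = refl
dyckFrom-concatMap f bal (x ∷ xs) = trans (dyckFrom-++ 0 0 (f x) (concatMap f xs) (bal x)) (dyckFrom-concatMap f bal xs)

dyckFrom-ups : (h j : ℕ) (B : List Step) → dyckFrom j (replicate h u ++ B) ≡ dyckFrom (h + j) B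
dyckFrom-ups zero    j B = refl
dyckFrom-ups (suc h) j B = trans (dyckFrom-u j _) (trans (dyckFrom-ups h (suc j) B) (cong (λ i → dyckFrom i B) (+-suc h j)))

dyckFrom-downs : (h : ℕ) → dyckFrom (h + 0) (replicate h d) ≡ true
dyckFrom-downs zero    = refl
dyckFrom-downs (suc h) = dyckFrom-downs h

length-pyramid : (h : ℕ) → length (pyramid h) ≡ h + h
length-pyramid h = trans (length-++ (replicate h u)) (cong₂ _+_ (length-replicate h) (length-replicate h))

dyckFrom-pyramid : (h : ℕ) → dyckFrom 0 (pyramid h) ≡ true
dyckFrom-pyramid h = trans (dyckFrom-ups h 0 (replicate h d)) (dyckFrom-downs h)

pyramids : List ℕ → List Step
pyramids = concatMap (λ i → pyramid (suc i))

shapeSize : AShape → ℕ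
shapeSize (pyr n)          = suc n
shapeSize (fan k i₁ i₂ is) = suc k + sum (map suc (i₁ ∷ i₂ ∷ is))

length-shapeSteps : (f : AShape) → length (shapeSteps f) ≡ shapeSize f + shapeSize f
length-shapeSteps (pyr n)          = length-pyramid (suc n)
length-shapeSteps (fan k i₁ i₂ is) = begin
  length (replicate (suc k) u ++ (pyramids is′ ++ replicate (suc k) d))
    ≡⟨ length-++ (replicate (suc k) u) ⟩
  length (replicate (suc k) u) + length (pyramids is′ ++ replicate (suc k) d)
    ≡⟨ cong (length (replicate (suc k) u) +_) (length-++ (pyramids is′)) ⟩
  length (replicate (suc k) u) + (length (pyramids is′) + length (replicate (suc k) d))
    ≡⟨ cong₂ (λ x y → x + (y + length (replicate (suc k) d))) (length-replicate (suc k)) pyramids-length ⟩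
  suc k + ((s + s) + length (replicate (suc k) d))
    ≡⟨ cong (λ x → suc k + ((s + s) + x)) (length-replicate (suc k)) ⟩
  suc k + ((s + s) + suc k)
    ≡⟨ wrap (suc k) s ⟩
  (suc k + s) + (suc k + s)
    ∎
  where
  open ≡-Reasoning
  is′ : List ℕ
  is′ = i₁ ∷ i₂ ∷ is
  s : ℕ
  s = sum (map suc is′)
  pyramids-length : length (pyramids is′) ≡ s + s
  pyramids-length = length-concatMap (λ i → pyramid (suc i)) suc (λ i → length-pyramid (suc i)) is′
  wrap : ∀ k s → k + ((s + s) + k) ≡ (k + s) + (k + s)
  wrap = solve-∀

dyckFrom-shapeSteps : (f : AShape) → dyckFrom 0 (shapeSteps f) ≡ true
dyckFrom-shapeSteps (pyr n)          = dyckFrom-pyramid (suc n)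
dyckFrom-shapeSteps (fan k i₁ i₂ is) =
  trans (dyckFrom-ups (suc k) 0 _)
        (trans (dyckFrom-++ 0 (suc k + 0) (pyramids (i₁ ∷ i₂ ∷ is)) (replicate (suc k) d)
                  (dyckFrom-concatMap (λ i → pyramid (suc i)) (λ i → dyckFrom-pyramid (suc i)) (i₁ ∷ i₂ ∷ is)))
               (dyckFrom-downs (suc k)))

module _ {X : Set} (size : X → ℕ) (p : X → Poly) where

  Termᵍ : Graded
  Termᵍ = graded (Σ X (λ x → Term (p x))) (λ (x , t) → size x , proj₁ t)

  Termsᵍ : Graded
  Termsᵍ = graded (Σ (List X) (λ xs → Terms (map p xs))) (λ (xs , ts) → sum (map size xs) , degrees (map p xs) ts)

  Terms≅List : Termsᵍ ≅ Listᵍ Termᵍ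
  Terms≅List = mk≅ (mk↔ₛ′ to from to∘from from∘to) preserved
    where
    to : Carrier Termsᵍ → List (Carrier Termᵍ)
    to ([]     , _)      = []
    to (x ∷ xs , t , ts) = (x , t) ∷ to (xs , ts)
    from : List (Carrier Termᵍ) → Carrier Termsᵍ
    from []             = [] , tt
    from ((x , t) ∷ ys) = let (xs , ts) = from ys in x ∷ xs , t , ts
    to∘from : ∀ ys → to (from ys) ≡ ys
    to∘from []             = refl
    to∘from ((x , t) ∷ ys) = cong ((x , t) ∷_) (to∘from ys)
    from∘to : ∀ m → from (to m) ≡ m
    from∘to ([]     , tt)     = refl
    from∘to (x ∷ xs , t , ts) = cong (λ (xs , ts) → x ∷ xs , t , ts) (from∘to (xs , ts))
    preserved : ∀ m → gradeSum (grade Termᵍ) (to m) ≡ grade Termsᵍ m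
    preserved ([]     , _)      = refl
    preserved (x ∷ xs , t , ts) = cong ((size x , proj₁ t) ⊕_) (preserved (xs , ts))

weight : AShape → Poly
weight = shapeWeight αN βN γN

Vᵍ : Graded
Vᵍ = graded (Σ ℕ (VCopies αN βN γN)) (λ (n , c) → n , degree c)

Factorisationᵍ : Graded
Factorisationᵍ = graded (Σ (List AShape) (λ fs → Term (prodP (map weight fs)))) (λ (fs , t) → sum (map shapeSize fs) , proj₁ t)

Vᵍ≅Factorisationᵍ : Vᵍ ≅ Factorisationᵍ
Vᵍ≅Factorisationᵍ = mk≅ (mk↔ₛ′ to from (λ _ → refl) from∘to) preserved
  where
  length-factors : (fs : List AShape) → length (concatMap shapeSteps fs) ≡ sum (map shapeSize fs) + sum (map shapeSize fs)
  length-factors = length-concatMap shapeSteps shapeSize length-shapeSteps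
  to : Σ ℕ (VCopies αN βN γN) → Carrier Factorisationᵍ
  to (_ , P , t) = factors P , t
  from : Carrier Factorisationᵍ → Σ ℕ (VCopies αN βN γN)
  from (fs , t) = sum (map shapeSize fs) ,
    mkV (mkDyck (concatMap shapeSteps fs) (length-factors fs) (dyckFrom-concatMap shapeSteps dyckFrom-shapeSteps fs)) fs refl , t
  size≡ : (n : ℕ) (fs : List AShape) → length (concatMap shapeSteps fs) ≡ n + n → sum (map shapeSize fs) ≡ n
  size≡ n fs l = double-injective _ n (trans (sym (length-factors fs)) l)
  from∘to : ∀ x → from (to x) ≡ x
  from∘to (n , mkV (mkDyck _ l b) fs refl , t) with size≡ n fs l
  ... | refl rewrite uip l (length-factors fs) | uip b (dyckFrom-concatMap shapeSteps dyckFrom-shapeSteps fs) = refl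
  preserved : ∀ x → grade Factorisationᵍ (to x) ≡ grade Vᵍ x
  preserved (n , mkV (mkDyck _ l _) fs refl , t) = cong (_, proj₁ t) (size≡ n fs l)

Factorisationᵍ≅Shapes : Factorisationᵍ ≅ Termsᵍ shapeSize weight
Factorisationᵍ≅Shapes =
  mk≅ (Σ-↔ʳ (λ fs → Term-prodP (map weight fs))) (λ (fs , t) → cong (_ ,_) (degree-prodP (map weight fs) t))

Pyramidᵍ : Graded
Pyramidᵍ = Termᵍ suc (λ m → γN (suc m))

FanIndex : Set
FanIndex = ℕ × ℕ × ℕ × List ℕ

fanOf : FanIndex → AShape
fanOf (k , i₁ , i₂ , is) = fan k i₁ i₂ is

Fanᵍ : Graded
Fanᵍ = Termᵍ (λ x → shapeSize (fanOf x)) (λ x → weight (fanOf x))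

Shape≅Pyramid⊎Fan : Termᵍ shapeSize weight ≅ (Pyramidᵍ ⊎ᵍ Fanᵍ)
Shape≅Pyramid⊎Fan = mk≅
  (mk↔ₛ′ (λ { (pyr m , t) → inj₁ (m , t) ; (fan k i₁ i₂ is , t) → inj₂ ((k , i₁ , i₂ , is) , t) })
         (λ { (inj₁ (m , t)) → pyr m , t ; (inj₂ (x , t)) → fanOf x , t })
         (λ { (inj₁ _) → refl ; (inj₂ _) → refl })
         (λ { (pyr _ , _) → refl ; (fan _ _ _ _ , _) → refl }))
  (λ { (pyr _ , _) → refl ; (fan _ _ _ _ , _) → refl })

Term-narayana : (m : ℕ) → Term (narayanaPoly m) ↔ Σ ℕ (Dyck m)
Term-narayana m = Σ-↔ʳ (λ k → ↔-sym (Dyck↔Fin-narayana m k))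

NonEmptyDyckᵍ : Graded
NonEmptyDyckᵍ = graded NonEmptyDyck (λ (m , k , _) → suc (suc m) , k)

-- γ has no x¹-coefficient, so the pyramid of height one carries no term.
Pyramidᵍ≅NonEmptyDyckᵍ : Pyramidᵍ ≅ NonEmptyDyckᵍ
Pyramidᵍ≅NonEmptyDyckᵍ = mk≅
  (mk↔ₛ′ (λ { (zero , _ , ()) ; (suc m , t) → m , Inverse.to (Term-narayana (suc m)) t })
         (λ (m , P) → suc m , Inverse.from (Term-narayana (suc m)) P)
         (λ (m , P) → cong (m ,_) (Inverse.strictlyInverseˡ (Term-narayana (suc m)) P))
         (λ { (zero , _ , ()) ; (suc m , t) → cong (suc m ,_) (Inverse.strictlyInverseʳ (Term-narayana (suc m)) t) }))
  (λ { (zero , _ , ()) ; (suc m , t) → refl })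

Betaᵍ : Graded
Betaᵍ = Termᵍ suc (λ k → βN (suc k))

Alphaᵍ : Graded
Alphaᵍ = Termᵍ suc (λ i → αN (suc i))

Alphasᵍ : Graded
Alphasᵍ = Termsᵍ suc (λ i → αN (suc i))

Fanᵍ≅Factors : Fanᵍ ≅ (Betaᵍ ×ᵍ Alphaᵍ ×ᵍ Alphaᵍ ×ᵍ Alphasᵍ)
Fanᵍ≅Factors = mk≅ factorise preserved
  where
  α′ : ℕ → Poly
  α′ i = αN (suc i)
  split : (k : ℕ) (is : ℕ × ℕ × List ℕ) → let (i₁ , i₂ , is) = is in
          Term (weight (fan k i₁ i₂ is)) ↔ (Term (βN (suc k)) × Terms (map α′ (i₁ ∷ i₂ ∷ is)))
  split k (i₁ , i₂ , is) = ↔-trans (Term-*P (βN (suc k)) _) (↔-refl ×-cong Term-prodP (map α′ (i₁ ∷ i₂ ∷ is)))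
  regroup : Σ FanIndex (λ (k , i₁ , i₂ , is) → Term (βN (suc k)) × Terms (map α′ (i₁ ∷ i₂ ∷ is))) ↔
            Carrier (Betaᵍ ×ᵍ Alphaᵍ ×ᵍ Alphaᵍ ×ᵍ Alphasᵍ)
  regroup = mk↔ₛ′ (λ ((k , i₁ , i₂ , is) , b , a₁ , a₂ , as) → (k , b) , (i₁ , a₁) , (i₂ , a₂) , (is , as))
                  (λ ((k , b) , (i₁ , a₁) , (i₂ , a₂) , (is , as)) → (k , i₁ , i₂ , is) , b , a₁ , a₂ , as)
                  (λ _ → refl) (λ _ → refl)
  factorise : Carrier Fanᵍ ↔ Carrier (Betaᵍ ×ᵍ Alphaᵍ ×ᵍ Alphaᵍ ×ᵍ Alphasᵍ)
  factorise = ↔-trans (Σ-↔ʳ λ (k , is) → split k is) regroup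
  preserved : ∀ x → grade (Betaᵍ ×ᵍ Alphaᵍ ×ᵍ Alphaᵍ ×ᵍ Alphasᵍ) (Inverse.to factorise x) ≡ grade Fanᵍ x
  preserved ((k , i₁ , i₂ , is) , t) = cong (_ ,_)
    (trans (cong (proj₁ (proj₁ bt) +_) (degree-prodP (map α′ (i₁ ∷ i₂ ∷ is)) (proj₂ bt)))
           (degree-*P (βN (suc k)) (prodP (map α′ (i₁ ∷ i₂ ∷ is))) t))
    where bt = Inverse.to (Term-*P (βN (suc k)) (prodP (map α′ (i₁ ∷ i₂ ∷ is)))) t

PeakedDyck : Set
PeakedDyck = Σ ℕ (λ m → Σ ℕ (λ j → Dyck (suc m) (suc j)))

PeakedDyckᵍ : Graded
PeakedDyckᵍ = graded PeakedDyck (λ (m , j , _) → suc m , j)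

Betaᵍ≅PeakedDyckᵍ : Betaᵍ ≅ PeakedDyckᵍ
Betaᵍ≅PeakedDyckᵍ = mk≅ (Σ-↔ʳ (λ m → Σ-↔ʳ (λ j → ↔-sym (Dyck↔Fin-narayana (suc m) (suc j))))) (λ _ → refl)

Unitᵍ : Graded
Unitᵍ = graded ⊤ (λ _ → 1 , 1)

Alphaᵍ≅Unitᵍ : Alphaᵍ ≅ Unitᵍ
Alphaᵍ≅Unitᵍ = mk≅ (mk↔ₛ′ (λ _ → tt) (λ _ → 0 , 1 , zero) (λ _ → refl) unique) preserved
  where
  unique : (a : Carrier Alphaᵍ) → (0 , 1 , zero) ≡ a
  unique (zero , suc zero , zero) = refl
  unique (suc _ , _ , ())
  preserved : (a : Carrier Alphaᵍ) → (1 , 1) ≡ grade Alphaᵍ a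
  preserved a = cong (grade Alphaᵍ) (unique a)

Lengthᵍ : Graded
Lengthᵍ = graded ℕ (λ r → r , r)

Units≅Lengthᵍ : Listᵍ Unitᵍ ≅ Lengthᵍ
Units≅Lengthᵍ = mk≅ (mk↔ₛ′ length (λ r → replicate r tt) (λ r → length-replicate r) replicate-length) preserved
  where
  replicate-length : (ts : List ⊤) → replicate (length ts) tt ≡ ts
  replicate-length []       = refl
  replicate-length (_ ∷ ts) = cong (tt ∷_) (replicate-length ts)
  preserved : (ts : List ⊤) → (length ts , length ts) ≡ gradeSum (λ _ → 1 , 1) ts
  preserved []       = refl
  preserved (_ ∷ ts) = cong ((1 , 1) ⊕_) (preserved ts)

FanPiecesᵍ : Graded
FanPiecesᵍ = PeakedDyckᵍ ×ᵍ Unitᵍ ×ᵍ Unitᵍ ×ᵍ Lengthᵍ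

Fanᵍ≅FanPiecesᵍ : Fanᵍ ≅ FanPiecesᵍ
Fanᵍ≅FanPiecesᵍ = ≅-trans Fanᵍ≅Factors
  (×-≅ Betaᵍ≅PeakedDyckᵍ (×-≅ Alphaᵍ≅Unitᵍ (×-≅ Alphaᵍ≅Unitᵍ
    (≅-trans (Terms≅List suc (λ i → αN (suc i))) (≅-trans (List-≅ Alphaᵍ≅Unitᵍ) Units≅Lengthᵍ)))))

-- A block with ℓ = 0 is a pyramid; one with ℓ = r + 1 is a fan with r + 2 pyramids of height one.
NonEmptyDyck⊎FanPieces≅Blockᵍ : (NonEmptyDyckᵍ ⊎ᵍ FanPiecesᵍ) ≅ Blockᵍ
NonEmptyDyck⊎FanPieces≅Blockᵍ = mk≅ (mk↔ₛ′ to from to∘from from∘to) preserved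
  where
  to : Carrier (NonEmptyDyckᵍ ⊎ᵍ FanPiecesᵍ) → Block
  to (inj₁ P)                            = P , 0
  to (inj₂ ((m , j , P) , _ , _ , r))    = (m , suc j , P) , suc r
  from : Block → Carrier (NonEmptyDyckᵍ ⊎ᵍ FanPiecesᵍ)
  from (P , zero)                  = inj₁ P
  from ((m , zero , P) , suc r)    with () ← Inverse.to (Dyck-suc-zero m) P
  from ((m , suc j , P) , suc r)   = inj₂ ((m , j , P) , tt , tt , r)
  to∘from : ∀ b → to (from b) ≡ b
  to∘from (P , zero)               = refl
  to∘from ((m , zero , P) , suc r) with () ← Inverse.to (Dyck-suc-zero m) P
  to∘from ((m , suc j , P) , suc r) = refl
  from∘to : ∀ x → from (to x) ≡ x
  from∘to (inj₁ P) = refl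
  from∘to (inj₂ _) = refl
  preserved : ∀ x → grade Blockᵍ (to x) ≡ grade (NonEmptyDyckᵍ ⊎ᵍ FanPiecesᵍ) x
  preserved (inj₁ (m , k , _))             = cong₂ _,_ (+-identityʳ _) (+-identityʳ k)
  preserved (inj₂ ((m , j , _) , _ , _ , r)) = cong₂ _,_ (cong suc (sym (+-suc m (suc r)))) (sym (+-suc j (suc r)))

Shapeᵍ≅Blockᵍ : Termᵍ shapeSize weight ≅ Blockᵍ
Shapeᵍ≅Blockᵍ =
  ≅-trans Shape≅Pyramid⊎Fan (≅-trans (⊎-≅ Pyramidᵍ≅NonEmptyDyckᵍ Fanᵍ≅FanPiecesᵍ) NonEmptyDyck⊎FanPieces≅Blockᵍ)

Vᵍ≅Blocks : Vᵍ ≅ Listᵍ Blockᵍ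
Vᵍ≅Blocks = ≅-trans Vᵍ≅Factorisationᵍ (≅-trans Factorisationᵍ≅Shapes
              (≅-trans (Terms≅List shapeSize weight) (List-≅ Shapeᵍ≅Blockᵍ)))

fibre-↔ : {F : ℕ → Set} (n : ℕ) → F n ↔ Σ (Σ ℕ F) (λ x → proj₁ x ≡ n)
fibre-↔ n = mk↔ₛ′ (λ c → (n , c) , refl) (λ { ((_ , c) , refl) → c }) (λ { ((_ , _) , refl) → refl }) (λ _ → refl)

Uᵍ≅Vᵍ : Uᵍ ≅ Vᵍ
Uᵍ≅Vᵍ = ≅-trans Uᵍ≅Blocks (≅-sym Vᵍ≅Blocks)

corollary3p8 : (n : ℕ) →
    Σ (UCopies n ⤖ VCopies αN βN γN n)
      (λ f → (c : UCopies n) → degree (Bijection.to f c) ≡ degree c)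
corollary3p8 n = ↔⇒⤖ U↔V , λ c →
  trans (degree-from-fibre (Inverse.to (OfSize-↔ Uᵍ≅Vᵍ n) ((n , c) , refl)))
        (cong proj₂ (grade-preserved Uᵍ≅Vᵍ (n , c)))
  where
  U↔V : UCopies n ↔ VCopies αN βN γN n
  U↔V = ↔-trans (fibre-↔ n) (↔-trans (OfSize-↔ Uᵍ≅Vᵍ n) (↔-sym (fibre-↔ n)))
  degree-from-fibre : (x : OfSize Vᵍ n) → degree (Inverse.from (fibre-↔ n) x) ≡ degree (proj₂ (proj₁ x))
  degree-from-fibre (_ , refl) = refl
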